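{- Let $X_1,\dots,X_k$ be commuting (classically) independent random variables having moments of all orders, and for each $i$ let $(R^{(i)}_n)_{n\ge1}$ be the free cumulants of $X_i$. Then for every $n\ge1$ the $n$th free cumulant $R_n$ of the product $X_1X_2\cdots X_k$ is given by $$R_n=\sum_{\substack{(\pi_1,\dots,\pi_k)\in NC(n)^k\\ \pi_1\vee\cdots\vee\pi_k=\mathbf{1}_n}}\ \prod_{i=1}^k R^{(i)}_{\pi_i},$$ the sum being over all $k$-tuples of noncrossing partitions of $\{1,\dots,n\}$ whose join is the one-block partition.
   Context: A set partition of $\{1,\dots,n\}$ is noncrossing if there are no $1\le a<b<c<d\le n$ with $a,c$ in one block and $b,d$ in a different block. $NC(n)$ denotes the set of noncrossing partitions of $\{1,\dots,n\}$, ordered by reverse refinement ($\pi\le\pi'$ iff every block of $\pi$ is contained in a block of $\pi'$); it is a lattice with largest element $\mathbf{1}_n$ (one block) and smallest element $\mathbf{0}_n$ (all singletons), and $\vee$ denotes the join in this lattice. For a sequence $(T_l)_{l\ge1}$ and $\pi\in NC(n)$, $T_\pi=\prod_{p\in\pi}T_{|p|}$, the product over blocks $p$ of $\pi$. If $(M_n)_{n\ge1}$ is the moment sequence of a random variable ($M_n=\mathbb E[X^n]$), its free cumulants $(R_n)_{n\ge1}$ are the unique numbers with $M_n=\sum_{\pi\in NC(n)}R_\pi$ for all $n\ge1$. -}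

module Defs where

open import Level using (Level)
open import Data.Bool using (Bool; true; false; _∧_; _∨_; not; if_then_else_)
open import Data.Nat using (ℕ; zero; suc; _<ᵇ_; _≤ᵇ_)
open import Data.Fin using (Fin; toℕ)
open import Data.Fin.Properties using () renaming (_≟_ to _≟F_)
open import Data.List using (List; []; _∷_; map; concatMap; filter; length; foldr; filterᵇ)
open import Data.List.Base using (allFin)
open import Data.Vec using (Vec; []; _∷_; lookup)
open import Relation.Nullary.Decidable using (⌊_⌋)
open import Algebra.Bundles using (CommutativeRing)

tuples : {a : Level} {A : Set a} → List A → (k : ℕ) → List (Vec A k)
tuples xs zero    = [] ∷ []
tuples xs (suc k) = concatMap (λ x → map (x ∷_) (tuples xs k)) xs

_==F_ : {n : ℕ} → Fin n → Fin n → Bool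
i ==F j = ⌊ i ≟F j ⌋

allL : {a : Level} {A : Set a} → (A → Bool) → List A → Bool
allL p []       = true
allL p (x ∷ xs) = p x ∧ allL p xs

allI : (n : ℕ) → (Fin n → Bool) → Bool
allI n p = allL p (allFin n)

-- Set partitions of {1,…,n} (here {0,…,n-1} = Fin n), encoded by the
-- canonical "minimal representative" map f : each i is sent to the
-- smallest element of its block.  Such maps are exactly those with
-- f i ≤ i and f (f i) = f i, and they are in bijection with set
-- partitions.

Part : ℕ → Set
Part n = Vec (Fin n) n

rep : {n : ℕ} → Part n → Fin n → Fin n
rep π i = lookup π i

sameBlock : {n : ℕ} → Part n → Fin n → Fin n → Bool
sameBlock π i j = rep π i ==F rep π j

isCanonical : {n : ℕ} → Part n → Bool
isCanonical {n} π =
  allI n (λ i → (toℕ (rep π i) ≤ᵇ toℕ i) ∧ (rep π (rep π i) ==F rep π i))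

isNoncrossing : {n : ℕ} → Part n → Bool
isNoncrossing {n} π =
  allI n λ a → allI n λ b → allI n λ c → allI n λ d →
    not ( (toℕ a <ᵇ toℕ b) ∧ (toℕ b <ᵇ toℕ c) ∧ (toℕ c <ᵇ toℕ d)
        ∧ sameBlock π a c ∧ sameBlock π b d ∧ not (sameBlock π a b))

NC : (n : ℕ) → List (Part n)
NC n = filterᵇ (λ π → isCanonical π ∧ isNoncrossing π) (tuples (allFin n) n)

refines : {n : ℕ} → Part n → Part n → Bool
refines {n} π σ = allI n λ i → allI n λ j →
  not (sameBlock π i j) ∨ sameBlock σ i j

isOne : {n : ℕ} → Part n → Bool
isOne {n} σ = allI n λ i → allI n λ j → sameBlock σ i j

-- the join (least upper bound in the lattice NC(n)) of π₁,…,π_k equals 1ₙ.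
-- Since 1ₙ is always an upper bound, this says: every upper bound of
-- π₁,…,π_k in NC(n) is 1ₙ (i.e. 1ₙ is the least upper bound).
joinIsOne : {n k : ℕ} → Vec (Part n) k → Bool
joinIsOne {n} {k} πs =
  allL (λ σ → not (allK πs σ) ∨ isOne σ) (NC n)
  where
  allK : {m : ℕ} → Vec (Part n) m → Part n → Bool
  allK []       σ = true
  allK (π ∷ ps) σ = refines π σ ∧ allK ps σ

blockSize : {n : ℕ} → Part n → Fin n → ℕ
blockSize {n} π i = length (filterᵇ (λ j → rep π j ==F i) (allFin n))

module _ {c ℓ : Level} (R : CommutativeRing c ℓ) where
  open CommutativeRing R

  sumR : List Carrier → Carrier
  sumR = foldr _+_ 0#

  prodR : List Carrier → Carrier
  prodR = foldr _*_ 1#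

  prodFin : (k : ℕ) → (Fin k → Carrier) → Carrier
  prodFin k f = prodR (map f (allFin k))

  multPart : {n : ℕ} → (ℕ → Carrier) → Part n → Carrier
  multPart {n} T π =
    prodR (map (λ i → T (blockSize π i))
               (filterᵇ (λ i → rep π i ==F i) (allFin n)))

  FreeCumulantsOf : (ℕ → Carrier) → (ℕ → Carrier) → Set ℓ
  FreeCumulantsOf M Rc = (n : ℕ) → 1 Data.Nat.≤ n →
    M n ≈ sumR (map (multPart Rc) (NC n))

  productFormula : (k : ℕ) → (Fin k → ℕ → Carrier) → ℕ → Carrier
  productFormula k Rs n =
    sumR (map (λ πs → prodFin k (λ i → multPart (Rs i) (lookup πs i)))
              (filterᵇ joinIsOne (tuples (NC n) k)))

-- Multiplying the moment-cumulant formulas of X₁, …, X_k writes the product of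
-- the moments, ∏ᵢ Mᵢ(n), as a sum over k-tuples (π₁, …, π_k) ∈ NC(n)ᵏ of
-- ∏ᵢ R⁽ⁱ⁾_{πᵢ}.  Group the tuples by their join σ.  A tuple with join σ refines σ
-- componentwise and is determined by its restrictions to the blocks V of σ,
-- which are arbitrary tuples in NC(|V|)ᵏ with join 1_{|V|}; as R_π is
-- multiplicative over blocks, the tuples with join σ contribute ∏_{V ∈ σ} P(|V|),
-- where P(m) is the right-hand side of the claimed formula.  Hence
-- ∏ᵢ Mᵢ(n) = Σ_{σ ∈ NC(n)} P_σ, so P satisfies the defining relation of the free
-- cumulants of the product, and these are unique: in M_n = Σ_π R_π the partition
-- 1ₙ contributes R_n and every other π only involves R_m with m < n.
module Submission where

open import Level using (Level; 0ℓ)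
open import Function using (_∘_; id; Equivalence)
open import Data.Empty using (⊥-elim)
open import Data.Unit using (tt)
open import Data.Bool using (Bool; true; false; T; not; _∧_; _∨_)
open import Data.Bool.Properties using (T?; T-∧)
open import Data.Nat as ℕ using (ℕ; zero; suc; _≤_; _<_)
import Data.Nat.Properties as ℕ
open import Data.Nat.Induction using (<-rec)
open import Data.Fin as Fin using (Fin; zero; suc; toℕ)
open import Data.Fin.Properties using (_≟_; toℕ-injective; ≤-antisym; ≤-refl; ≤-reflexive; <-irrefl; <-asym; <-cmp; all?)
open import Data.Maybe as Maybe using (Maybe; just; nothing; fromMaybe)
open import Data.Product using (_×_; _,_; proj₁; proj₂; ∃)
import Data.Product.Properties as Product
open import Data.Sum using (_⊎_; inj₁; inj₂)
open import Data.List as List using (List; []; _∷_; [_]; map; filter; filterᵇ; foldr; length; _++_; concatMap; cartesianProduct; cartesianProductWith; allFin)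
open import Data.List.Properties using (filter-≐; filter-none; filter-accept; filter-all; filter-complete; filter-some; length-filter; length-map; length-tabulate; map-tabulate; tabulate-lookup)
open import Data.List.Membership.Propositional using (_∈_; lose)
open import Data.List.Membership.Propositional.Properties using (∈-filter⁺; ∈-filter⁻; ∈-allFin; ∈-lookup; ∈-cartesianProduct⁺; ∈-cartesianProduct⁻; ∈-cartesianProductWith⁺; ∈-cartesianProductWith⁻)
open import Data.List.Relation.Unary.Any as Any using (here; there; any?)
open import Data.List.Relation.Unary.Any.Properties using (lookup-index)
open import Data.List.Relation.Unary.All as All using (All; []; _∷_)
open import Data.List.Relation.Unary.AllPairs as AllPairs using (AllPairs; []; _∷_)
import Data.List.Relation.Unary.AllPairs.Properties as AllPairs
open import Data.List.Relation.Unary.Unique.Propositional using (Unique)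
import Data.List.Relation.Unary.Unique.Propositional.Properties as Unique
open import Data.Vec as Vec using (Vec; []; _∷_; lookup; tabulate; replicate; zipWith)
open import Data.Vec.Properties as Vec using (lookup∘tabulate; tabulate∘lookup; tabulate-cong; lookup-replicate; lookup-map; lookup-zipWith; map-∘; map-cong; ∷-injective)
open import Relation.Nullary using (¬_; Dec; yes; no)
open import Relation.Nullary.Decidable using (map′; ¬?; _×-dec_; _⊎-dec_; _→-dec_; toWitness; fromWitness)
open import Relation.Unary using (Pred; Decidable)
open import Relation.Unary.Properties using (_∩?_)
open import Relation.Binary using (Rel; IsEquivalence; DecidableEquality; tri<; tri≈; tri>) renaming (Decidable to Decidable₂)
import Relation.Binary.Construct.On as On
open import Relation.Binary.PropositionalEquality using (_≡_; _≢_; refl; sym; trans; cong; cong₂; subst; subst₂; module ≡-Reasoning)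
import Relation.Binary.PropositionalEquality.Properties as ≡
open import Algebra.Bundles using (CommutativeMonoid; CommutativeRing)

open import Defs

open Equivalence using (to; from)

private variable
  a ℓ p q : Level
  A B : Set a
  m n k : ℕ

-- Lists and big operators

filter-filter : {P : Pred A p} {Q : Pred A q} (P? : Decidable P) (Q? : Decidable Q) (xs : List A) →
                filter P? (filter Q? xs) ≡ filter (P? ∩? Q?) xs
filter-filter P? Q? [] = refl
filter-filter P? Q? (x ∷ xs) with Q? x
... | yes _ with P? x
...   | yes _ = cong (x ∷_) (filter-filter P? Q? xs)
...   | no _  = filter-filter P? Q? xs
filter-filter P? Q? (x ∷ xs) | no _ with P? x
...   | yes _ = filter-filter P? Q? xs
...   | no _  = filter-filter P? Q? xs

filter-map : {P : Pred B p} (P? : Decidable P) (f : A → B) (xs : List A) →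
             filter P? (map f xs) ≡ map f (filter (P? ∘ f) xs)
filter-map P? f [] = refl
filter-map P? f (x ∷ xs) with P? (f x)
... | yes _ = cong (f x ∷_) (filter-map P? f xs)
... | no _  = filter-map P? f xs

filter-unique : {P : Pred A p} (P? : Decidable P) {xs : List A} {x : A} → Unique xs → x ∈ xs → P x →
                (∀ {y} → y ∈ xs → P y → y ≡ x) → filter P? xs ≡ [ x ]
filter-unique P? {y ∷ ys} (y∉ys ∷ _) (here refl) py only =
  trans (filter-accept P? py)
        (cong (y ∷_) (filter-none P? (All.tabulate λ {z} z∈ys pz → All.lookup y∉ys z∈ys (sym (only (there z∈ys) pz)))))
filter-unique P? {y ∷ ys} (y∉ys ∷ ys!) (there x∈ys) px only with P? y
... | yes py = ⊥-elim (All.lookup y∉ys x∈ys (only (here refl) py))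
... | no _   = filter-unique P? ys! x∈ys px (only ∘ there)

module BigSum {c ℓ} (M : CommutativeMonoid c ℓ) where
  open CommutativeMonoid M renaming (refl to ≈-refl; sym to ≈-sym; trans to ≈-trans; reflexive to ≈-reflexive)
  open import Relation.Binary.Reasoning.Setoid setoid
  open import Algebra.Properties.CommutativeSemigroup commutativeSemigroup using (interchange)

  ∑ : (A → Carrier) → List A → Carrier
  ∑ f xs = foldr _∙_ ε (map f xs)

  ∑-cong : {f g : A → Carrier} (xs : List A) → (∀ {x} → x ∈ xs → f x ≈ g x) → ∑ f xs ≈ ∑ g xs
  ∑-cong [] _ = ≈-refl
  ∑-cong (x ∷ xs) f≈g = ∙-cong (f≈g (here refl)) (∑-cong xs (f≈g ∘ there))

  ∑-map : (f : B → Carrier) (h : A → B) (xs : List A) → ∑ f (map h xs) ≡ ∑ (f ∘ h) xs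
  ∑-map f h [] = refl
  ∑-map f h (x ∷ xs) = cong (f (h x) ∙_) (∑-map f h xs)

  ∑-allFin-suc : {k : ℕ} (f : Fin (suc k) → Carrier) → ∑ f (allFin (suc k)) ≡ f zero ∙ ∑ (f ∘ suc) (allFin k)
  ∑-allFin-suc {k} f = cong (f zero ∙_) (trans (cong (∑ f) (sym (map-tabulate id suc))) (∑-map f suc (allFin k)))

  ∑-++ : (f : A → Carrier) (xs ys : List A) → ∑ f (xs ++ ys) ≈ ∑ f xs ∙ ∑ f ys
  ∑-++ f [] ys = ≈-sym (identityˡ _)
  ∑-++ f (x ∷ xs) ys = ≈-trans (∙-cong ≈-refl (∑-++ f xs ys)) (≈-sym (assoc _ _ _))

  ∑-concatMap : (f : B → Carrier) (g : A → List B) (xs : List A) → ∑ f (concatMap g xs) ≈ ∑ (λ x → ∑ f (g x)) xs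
  ∑-concatMap f g [] = ≈-refl
  ∑-concatMap f g (x ∷ xs) = ≈-trans (∑-++ f (g x) (concatMap g xs)) (∙-cong ≈-refl (∑-concatMap f g xs))

  ∑-cartesianProduct : (h : A × B → Carrier) (xs : List A) (ys : List B) →
                       ∑ h (cartesianProduct xs ys) ≈ ∑ (λ x → ∑ (λ y → h (x , y)) ys) xs
  ∑-cartesianProduct h [] ys = ≈-refl
  ∑-cartesianProduct h (x ∷ xs) ys = begin
    ∑ h (map (x ,_) ys ++ cartesianProduct xs ys)         ≈⟨ ∑-++ h (map (x ,_) ys) _ ⟩
    ∑ h (map (x ,_) ys) ∙ ∑ h (cartesianProduct xs ys)     ≈⟨ ∙-cong (≈-reflexive (∑-map h (x ,_) ys)) (∑-cartesianProduct h xs ys) ⟩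
    ∑ (λ y → h (x , y)) ys ∙ ∑ (λ x → ∑ (λ y → h (x , y)) ys) xs ∎

  ∑-tuples-suc : (xs : List A) (k : ℕ) (h : Vec A (suc k) → Carrier) →
                 ∑ h (tuples xs (suc k)) ≈ ∑ (λ x → ∑ (λ v → h (x ∷ v)) (tuples xs k)) xs
  ∑-tuples-suc xs k h = begin
    ∑ h (concatMap (λ x → map (x ∷_) (tuples xs k)) xs)  ≈⟨ ∑-concatMap h _ xs ⟩
    ∑ (λ x → ∑ h (map (x ∷_) (tuples xs k))) xs          ≈⟨ ∑-cong xs (λ {x} _ → ≈-reflexive (∑-map h (x ∷_) (tuples xs k))) ⟩
    ∑ (λ x → ∑ (λ v → h (x ∷ v)) (tuples xs k)) xs       ∎

  ∑-zero : {f : A → Carrier} (xs : List A) → (∀ {x} → x ∈ xs → f x ≈ ε) → ∑ f xs ≈ ε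
  ∑-zero [] _ = ≈-refl
  ∑-zero (x ∷ xs) f≈ε = ≈-trans (∙-cong (f≈ε (here refl)) (∑-zero xs (f≈ε ∘ there))) (identityˡ ε)

  ∑-∙ : (f g : A → Carrier) (xs : List A) → ∑ (λ x → f x ∙ g x) xs ≈ ∑ f xs ∙ ∑ g xs
  ∑-∙ f g [] = ≈-sym (identityˡ ε)
  ∑-∙ f g (x ∷ xs) = ≈-trans (∙-cong ≈-refl (∑-∙ f g xs)) (interchange (f x) (g x) (∑ f xs) (∑ g xs))

  ∑-swap : (h : A → B → Carrier) (xs : List A) (ys : List B) →
           ∑ (λ x → ∑ (h x) ys) xs ≈ ∑ (λ y → ∑ (λ x → h x y) xs) ys
  ∑-swap h [] ys = ≈-sym (∑-zero ys (λ _ → ≈-refl))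
  ∑-swap h (x ∷ xs) ys = ≈-trans (∙-cong ≈-refl (∑-swap h xs ys)) (≈-sym (∑-∙ (h x) (λ y → ∑ (λ x → h x y) xs) ys))

  ∑-filter : {P : Pred A p} (P? : Decidable P) (f : A → Carrier) (xs : List A) →
             ∑ f xs ≈ ∑ f (filter P? xs) ∙ ∑ f (filter (¬? ∘ P?) xs)
  ∑-filter P? f [] = ≈-sym (identityˡ ε)
  ∑-filter {A = A} P? f (x ∷ xs) with P? x
  ... | yes _ = ≈-trans (∙-cong ≈-refl (∑-filter P? f xs)) (≈-sym (assoc _ _ _))
  ... | no _  = begin
    f x ∙ ∑ f xs                               ≈⟨ ∙-cong ≈-refl (∑-filter P? f xs) ⟩
    f x ∙ (∑ f (filter P? xs) ∙ ∑ f rejected)  ≈⟨ ≈-sym (assoc _ _ _) ⟩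
    (f x ∙ ∑ f (filter P? xs)) ∙ ∑ f rejected  ≈⟨ ∙-cong (comm _ _) ≈-refl ⟩
    (∑ f (filter P? xs) ∙ f x) ∙ ∑ f rejected  ≈⟨ assoc _ _ _ ⟩
    ∑ f (filter P? xs) ∙ (f x ∙ ∑ f rejected)  ∎
    where
    rejected : List A
    rejected = filter (¬? ∘ P?) xs

  module _ (_≟_ : DecidableEquality B) where

    ∑-remove : (f : B → Carrier) {ys : List B} {y : B} → Unique ys → y ∈ ys →
               ∑ f ys ≈ f y ∙ ∑ f (filter (λ z → ¬? (z ≟ y)) ys)
    ∑-remove f {ys} {y} ys! y∈ys = begin
      ∑ f ys                                                    ≈⟨ ∑-filter (_≟ y) f ys ⟩
      ∑ f (filter (_≟ y) ys) ∙ ∑ f (filter (λ z → ¬? (z ≟ y)) ys) ≡⟨ cong (λ l → ∑ f l ∙ ∑ f (filter (λ z → ¬? (z ≟ y)) ys)) (filter-unique (_≟ y) ys! y∈ys refl (λ _ e → e)) ⟩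
      (f y ∙ ε) ∙ ∑ f (filter (λ z → ¬? (z ≟ y)) ys)             ≈⟨ ∙-cong (identityʳ _) ≈-refl ⟩
      f y ∙ ∑ f (filter (λ z → ¬? (z ≟ y)) ys)                   ∎

    ∑-reindex : (f : A → Carrier) (g : B → Carrier) (φ : A → B) (ψ : B → A) {xs : List A} {ys : List B} →
                Unique xs → Unique ys →
                (∀ {x} → x ∈ xs → φ x ∈ ys) → (∀ {y} → y ∈ ys → ψ y ∈ xs) →
                (∀ {x} → x ∈ xs → ψ (φ x) ≡ x) → (∀ {y} → y ∈ ys → φ (ψ y) ≡ y) →
                (∀ {x} → x ∈ xs → f x ≈ g (φ x)) → ∑ f xs ≈ ∑ g ys
    ∑-reindex f g φ ψ {[]} {[]} _ _ _ _ _ _ _ = ≈-refl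
    ∑-reindex f g φ ψ {[]} {y ∷ ys} _ _ _ ψ∈ _ _ _ with ψ∈ (here refl)
    ... | ()
    ∑-reindex f g φ ψ {x ∷ xs} {ys} (x∉xs ∷ xs!) ys! φ∈ ψ∈ ψφ φψ f≈g = begin
      f x ∙ ∑ f xs           ≈⟨ ∙-cong (f≈g (here refl)) (∑-reindex f g φ ψ xs! (Unique.filter⁺ ≢φx ys!) φ∈′ ψ∈′ (ψφ ∘ there) (φψ ∘ proj₁ ∘ ∈-filter⁻ ≢φx) (f≈g ∘ there)) ⟩
      g (φ x) ∙ ∑ g ys∖φx    ≈⟨ ≈-sym (∑-remove g ys! (φ∈ (here refl))) ⟩
      ∑ g ys                 ∎
      where
      ≢φx : Decidable (_≢ φ x)
      ≢φx y = ¬? (y ≟ φ x)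
      ys∖φx : List B
      ys∖φx = filter ≢φx ys
      φ∈′ : ∀ {x′} → x′ ∈ xs → φ x′ ∈ ys∖φx
      φ∈′ x′∈xs = ∈-filter⁺ ≢φx (φ∈ (there x′∈xs))
        (λ e → All.lookup x∉xs x′∈xs (trans (sym (ψφ (here refl))) (trans (cong ψ (sym e)) (ψφ (there x′∈xs)))))
      ψ∈′ : ∀ {y} → y ∈ ys∖φx → ψ y ∈ xs
      ψ∈′ y∈ with ∈-filter⁻ ≢φx y∈
      ... | y∈ys , y≢φx with ψ∈ y∈ys
      ...   | here e     = ⊥-elim (y≢φx (trans (sym (φψ y∈ys)) (cong φ e)))
      ...   | there ψy∈ = ψy∈

    ∑-fibres : (f : A → Carrier) (g : A → B) (xs : List A) {rs : List B} → Unique rs → (∀ {x} → x ∈ xs → g x ∈ rs) →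
               ∑ f xs ≈ ∑ (λ r → ∑ f (filter (λ x → g x ≟ r) xs)) rs
    ∑-fibres f g [] {[]} _ _ = ≈-refl
    ∑-fibres f g (x ∷ xs) {[]} _ g∈ with g∈ (here refl)
    ... | ()
    ∑-fibres f g [] {r ∷ rs} _ _ = ≈-sym (≈-trans (identityˡ _) (∑-zero rs (λ _ → ≈-refl)))
    ∑-fibres {A = A} f g xs@(_ ∷ _) {r ∷ rs} (r∉rs ∷ rs!) g∈ = begin
      ∑ f xs                                                         ≈⟨ ∑-filter (λ x → g x ≟ r) f xs ⟩
      ∑ f (filter (λ x → g x ≟ r) xs) ∙ ∑ f xs∖r                      ≈⟨ ∙-cong ≈-refl (∑-fibres f g xs∖r rs! g∈′) ⟩
      ∑ f (filter (λ x → g x ≟ r) xs) ∙ ∑ (λ r′ → ∑ f (filter (λ x → g x ≟ r′) xs∖r)) rs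
        ≈⟨ ∙-cong ≈-refl (∑-cong rs (λ r′∈rs → ≈-reflexive (cong (∑ f) (drop-r r′∈rs)))) ⟩
      ∑ f (filter (λ x → g x ≟ r) xs) ∙ ∑ (λ r′ → ∑ f (filter (λ x → g x ≟ r′) xs)) rs ∎
      where
      ≢r : Decidable (λ x → g x ≢ r)
      ≢r x = ¬? (g x ≟ r)
      xs∖r : List A
      xs∖r = filter ≢r xs
      g∈′ : ∀ {x} → x ∈ xs∖r → g x ∈ rs
      g∈′ x∈ with ∈-filter⁻ ≢r x∈
      ... | x∈xs , gx≢r with g∈ x∈xs
      ...   | here e     = ⊥-elim (gx≢r e)
      ...   | there gx∈ = gx∈
      drop-r : ∀ {r′} → r′ ∈ rs → filter (λ x → g x ≟ r′) xs∖r ≡ filter (λ x → g x ≟ r′) xs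
      drop-r {r′} r′∈rs = trans (filter-filter (λ x → g x ≟ r′) ≢r xs)
        (filter-≐ ((λ x → g x ≟ r′) ∩? ≢r) (λ x → g x ≟ r′) ((λ (e , _) → e) , (λ e → e , λ e′ → All.lookup r∉rs r′∈rs (trans (sym e′) e))) xs)

module BigOperators {c ℓ} (R : CommutativeRing c ℓ) where
  open CommutativeRing R hiding (zero) renaming (refl to ≈-refl; sym to ≈-sym; trans to ≈-trans; reflexive to ≈-reflexive)
  open import Relation.Binary.Reasoning.Setoid setoid
  open BigSum +-commutativeMonoid public
  open BigSum *-commutativeMonoid public
    using () renaming (∑ to ∏; ∑-cong to ∏-cong; ∑-map to ∏-map; ∑-allFin-suc to ∏-allFin-suc; ∑-swap to ∏-swap; ∑-fibres to ∏-fibres)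

  ∑-distribˡ : (z : Carrier) (f : A → Carrier) (xs : List A) → z * ∑ f xs ≈ ∑ (λ x → z * f x) xs
  ∑-distribˡ z f [] = zeroʳ z
  ∑-distribˡ z f (x ∷ xs) = ≈-trans (distribˡ z (f x) (∑ f xs)) (+-cong ≈-refl (∑-distribˡ z f xs))

  ∑-distribʳ : (z : Carrier) (f : A → Carrier) (xs : List A) → ∑ f xs * z ≈ ∑ (λ x → f x * z) xs
  ∑-distribʳ z f [] = zeroˡ z
  ∑-distribʳ z f (x ∷ xs) = ≈-trans (distribʳ z (f x) (∑ f xs)) (+-cong ≈-refl (∑-distribʳ z f xs))

  ∑-*-∑ : (f : A → Carrier) (g : B → Carrier) (xs : List A) (ys : List B) →
          ∑ f xs * ∑ g ys ≈ ∑ (λ x → ∑ (λ y → f x * g y) ys) xs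
  ∑-*-∑ f g xs ys = ≈-trans (∑-distribʳ (∑ g ys) f xs) (∑-cong xs (λ {x} _ → ∑-distribˡ (f x) g ys))

  ∏-∑-tuples : (k : ℕ) (g : Fin k → A → Carrier) (xs : List A) →
               ∏ (λ i → ∑ (g i) xs) (allFin k) ≈ ∑ (λ v → ∏ (λ i → g i (lookup v i)) (allFin k)) (tuples xs k)
  ∏-∑-tuples zero g xs = ≈-sym (+-identityʳ 1#)
  ∏-∑-tuples (suc k) g xs = begin
    ∏ (λ i → ∑ (g i) xs) (allFin (suc k))
      ≡⟨ ∏-allFin-suc (λ i → ∑ (g i) xs) ⟩
    ∑ (g zero) xs * ∏ (λ i → ∑ (g (suc i)) xs) (allFin k)
      ≈⟨ *-cong ≈-refl (∏-∑-tuples k (g ∘ suc) xs) ⟩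
    ∑ (g zero) xs * ∑ (λ v → ∏ (λ i → g (suc i) (lookup v i)) (allFin k)) (tuples xs k)
      ≈⟨ ∑-*-∑ (g zero) _ xs (tuples xs k) ⟩
    ∑ (λ x → ∑ (λ v → g zero x * ∏ (λ i → g (suc i) (lookup v i)) (allFin k)) (tuples xs k)) xs
      ≈⟨ ∑-cong xs (λ {x} _ → ∑-cong (tuples xs k) (λ {v} _ → ≈-reflexive (sym (∏-allFin-suc (λ i → g i (lookup (x ∷ v) i)))))) ⟩
    ∑ (λ x → ∑ (λ v → ∏ (λ i → g i (lookup (x ∷ v) i)) (allFin (suc k))) (tuples xs k)) xs
      ≈⟨ ≈-sym (∑-tuples-suc xs k (λ v → ∏ (λ i → g i (lookup v i)) (allFin (suc k)))) ⟩
    ∑ (λ v → ∏ (λ i → g i (lookup v i)) (allFin (suc k))) (tuples xs (suc k)) ∎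

-- Partitions as equivalence relations

T-not⁺ : ∀ {x} → ¬ T x → T (not x)
T-not⁺ {true}  ¬x = ¬x tt
T-not⁺ {false} _  = tt

T-not⁻ : ∀ {x} → T (not x) → ¬ T x
T-not⁻ {true} ()

T-⇒⁺ : ∀ {x y} → (T x → T y) → T (not x ∨ y)
T-⇒⁺ {true}  x⇒y = x⇒y tt
T-⇒⁺ {false} _   = tt

T-⇒⁻ : ∀ {x y} → T (not x ∨ y) → T x → T y
T-⇒⁻ {true} y _ = y

allL⁺ : (p : A → Bool) (xs : List A) → (∀ {x} → x ∈ xs → T (p x)) → T (allL p xs)
allL⁺ p []       _  = tt
allL⁺ p (x ∷ xs) ps = from T-∧ (ps (here refl) , allL⁺ p xs (ps ∘ there))

allL⁻ : (p : A → Bool) (xs : List A) → T (allL p xs) → ∀ {x} → x ∈ xs → T (p x)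
allL⁻ p (x ∷ xs) t (here refl) = proj₁ (to T-∧ t)
allL⁻ p (x ∷ xs) t (there x∈)  = allL⁻ p xs (proj₂ (to T-∧ t)) x∈

allI⁺ : (p : Fin n → Bool) → (∀ i → T (p i)) → T (allI n p)
allI⁺ {n} p ps = allL⁺ p (allFin n) (λ {i} _ → ps i)

allI⁻ : (p : Fin n → Bool) → T (allI n p) → ∀ i → T (p i)
allI⁻ {n} p t i = allL⁻ p (allFin n) t (∈-allFin i)

lookup-ext : {u v : Vec A n} → (∀ i → lookup u i ≡ lookup v i) → u ≡ v
lookup-ext {u = u} {v} u≗v = trans (sym (tabulate∘lookup u)) (trans (tabulate-cong u≗v) (tabulate∘lookup v))

module _ {n : ℕ} where

  _∼[_]_ : Fin n → Part n → Fin n → Set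
  a ∼[ π ] b = rep π a ≡ rep π b

  IsCanonical : Part n → Set
  IsCanonical π = ∀ i → rep π i Fin.≤ i × rep π (rep π i) ≡ rep π i

  Noncrossing : Part n → Set
  Noncrossing π = ∀ a b c d → a Fin.< b → b Fin.< c → c Fin.< d → a ∼[ π ] c → b ∼[ π ] d → a ∼[ π ] b

  _⊑_ : Part n → Part n → Set
  π ⊑ σ = ∀ a b → a ∼[ π ] b → a ∼[ σ ] b

  IsOne : Part n → Set
  IsOne σ = ∀ a b → a ∼[ σ ] b

  ⊑-refl : {π : Part n} → π ⊑ π
  ⊑-refl _ _ a∼b = a∼b

  rep-∼ : (π : Part n) → IsCanonical π → ∀ a → a ∼[ π ] rep π a
  rep-∼ π π-can a = sym (proj₂ (π-can a))

  rep-least : (π : Part n) → IsCanonical π → ∀ {a b} → a ∼[ π ] b → rep π a Fin.≤ b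
  rep-least π π-can {a} {b} a∼b = subst (Fin._≤ b) (sym a∼b) (proj₁ (π-can b))

  ⊑-antisym : (π σ : Part n) → IsCanonical π → IsCanonical σ → π ⊑ σ → σ ⊑ π → π ≡ σ
  ⊑-antisym π σ π-can σ-can π⊑σ σ⊑π = lookup-ext same-rep
    where
    same-rep : ∀ i → rep π i ≡ rep σ i
    same-rep i = ≤-antisym (rep-least π π-can (σ⊑π i (rep σ i) (rep-∼ σ σ-can i)))
                           (rep-least σ σ-can (π⊑σ i (rep π i) (rep-∼ π π-can i)))

  sameBlock⁺ : (π : Part n) {a b : Fin n} → a ∼[ π ] b → T (sameBlock π a b)
  sameBlock⁺ π = fromWitness

  sameBlock⁻ : (π : Part n) {a b : Fin n} → T (sameBlock π a b) → a ∼[ π ] b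
  sameBlock⁻ π = toWitness

  isCanonical⁺ : (π : Part n) → IsCanonical π → T (isCanonical π)
  isCanonical⁺ π π-can = allI⁺ _ (λ i → from T-∧ (ℕ.≤⇒≤ᵇ (proj₁ (π-can i)) , fromWitness (proj₂ (π-can i))))

  isCanonical⁻ : (π : Part n) → T (isCanonical π) → IsCanonical π
  isCanonical⁻ π t i with to T-∧ (allI⁻ _ t i)
  ... | le , idem = ℕ.≤ᵇ⇒≤ _ _ le , toWitness idem

  isNoncrossing⁺ : (π : Part n) → Noncrossing π → T (isNoncrossing π)
  isNoncrossing⁺ π nc = allI⁺ _ λ a → allI⁺ _ λ b → allI⁺ _ λ c → allI⁺ _ λ d → T-not⁺ λ t →
    let a<b , t = to T-∧ t ; b<c , t = to T-∧ t ; c<d , t = to T-∧ t ; a∼c , t = to T-∧ t ; b∼d , a≁b = to T-∧ t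
    in T-not⁻ a≁b (sameBlock⁺ π (nc a b c d (ℕ.<ᵇ⇒< _ _ a<b) (ℕ.<ᵇ⇒< _ _ b<c) (ℕ.<ᵇ⇒< _ _ c<d) (sameBlock⁻ π a∼c) (sameBlock⁻ π b∼d)))

  isNoncrossing⁻ : (π : Part n) → T (isNoncrossing π) → Noncrossing π
  isNoncrossing⁻ π t a b c d a<b b<c c<d a∼c b∼d with rep π a ≟ rep π b
  ... | yes a∼b = a∼b
  ... | no  a≁b = ⊥-elim (T-not⁻ (allI⁻ _ (allI⁻ _ (allI⁻ _ (allI⁻ _ t a) b) c) d)
          (from T-∧ (ℕ.<⇒<ᵇ a<b , from T-∧ (ℕ.<⇒<ᵇ b<c , from T-∧ (ℕ.<⇒<ᵇ c<d ,
           from T-∧ (sameBlock⁺ π a∼c , from T-∧ (sameBlock⁺ π b∼d , T-not⁺ (a≁b ∘ sameBlock⁻ π))))))))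

  refines⁺ : (π σ : Part n) → π ⊑ σ → T (refines π σ)
  refines⁺ π σ π⊑σ = allI⁺ _ λ a → allI⁺ _ λ b → T-⇒⁺ (sameBlock⁺ σ ∘ π⊑σ a b ∘ sameBlock⁻ π)

  refines⁻ : (π σ : Part n) → T (refines π σ) → π ⊑ σ
  refines⁻ π σ t a b = sameBlock⁻ σ ∘ T-⇒⁻ (allI⁻ _ (allI⁻ _ t a) b) ∘ sameBlock⁺ π

  _⊑?_ : Decidable₂ _⊑_
  π ⊑? σ = map′ (refines⁻ π σ) (refines⁺ π σ) (T? (refines π σ))

  isOne⁺ : (σ : Part n) → IsOne σ → T (isOne σ)
  isOne⁺ σ one = allI⁺ _ λ a → allI⁺ _ λ b → sameBlock⁺ σ (one a b)

  isOne⁻ : (σ : Part n) → T (isOne σ) → IsOne σ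
  isOne⁻ σ t a b = sameBlock⁻ σ (allI⁻ _ (allI⁻ _ t a) b)

tuples-suc : (xs : List A) (k : ℕ) → tuples xs (suc k) ≡ cartesianProductWith _∷_ xs (tuples xs k)
tuples-suc xs k = go xs
  where
  go : ∀ ys → concatMap (λ x → map (x ∷_) (tuples xs k)) ys ≡ cartesianProductWith _∷_ ys (tuples xs k)
  go []       = refl
  go (y ∷ ys) = cong (map (y ∷_) (tuples xs k) ++_) (go ys)

tuples-unique : {xs : List A} (k : ℕ) → Unique xs → Unique (tuples xs k)
tuples-unique zero    xs! = [] ∷ []
tuples-unique {xs = xs} (suc k) xs! =
  subst Unique (sym (tuples-suc xs k)) (Unique.cartesianProductWith⁺ _∷_ ∷-injective xs! (tuples-unique k xs!))

∈-tuples⁺ : {xs : List A} {v : Vec A k} → (∀ i → lookup v i ∈ xs) → v ∈ tuples xs k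
∈-tuples⁺ {v = []}    _  = here refl
∈-tuples⁺ {xs = xs} {v = x ∷ v} v∈ =
  subst (_ ∈_) (sym (tuples-suc xs _)) (∈-cartesianProductWith⁺ _∷_ (v∈ zero) (∈-tuples⁺ (v∈ ∘ suc)))

∈-tuples⁻ : {xs : List A} {v : Vec A k} → v ∈ tuples xs k → ∀ i → lookup v i ∈ xs
∈-tuples⁻ {k = suc k} {xs = xs} v∈ i with ∈-cartesianProductWith⁻ _∷_ xs (tuples xs k) (subst (_ ∈_) (tuples-suc xs k) v∈)
∈-tuples⁻ v∈ zero    | x , w , x∈ , w∈ , refl = x∈
∈-tuples⁻ v∈ (suc i) | x , w , x∈ , w∈ , refl = ∈-tuples⁻ w∈ i

NC-unique : ∀ n → Unique (NC n)
NC-unique n = Unique.filter⁺ (T? ∘ λ π → isCanonical π ∧ isNoncrossing π) (tuples-unique n (Unique.allFin⁺ n))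

∈-NC⁺ : {π : Part n} → IsCanonical π → Noncrossing π → π ∈ NC n
∈-NC⁺ {n} {π} π-can π-nc = ∈-filter⁺ (T? ∘ λ π → isCanonical π ∧ isNoncrossing π) (∈-tuples⁺ (λ _ → ∈-allFin _))
  (from T-∧ (isCanonical⁺ π π-can , isNoncrossing⁺ π π-nc))

∈-NC⁻ : {π : Part n} → π ∈ NC n → IsCanonical π × Noncrossing π
∈-NC⁻ {n} {π} π∈ with to T-∧ (proj₂ (∈-filter⁻ (T? ∘ λ π → isCanonical π ∧ isNoncrossing π) {xs = tuples (allFin n) n} π∈))
... | can , nc = isCanonical⁻ π can , isNoncrossing⁻ π nc

search : {P : Pred (Fin n) ℓ} → Decidable P → Maybe (Fin n)
search {zero}  P? = nothing
search {suc n} P? with P? zero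
... | yes _ = just zero
... | no _  = Maybe.map suc (search (P? ∘ suc))

search-least : {P : Pred (Fin n) ℓ} (P? : Decidable P) {i : Fin n} → P i →
               ∃ λ j → search P? ≡ just j × P j × (∀ {i′} → P i′ → j Fin.≤ i′)
search-least {suc n} P? {i} pi with P? zero
... | yes p0 = zero , refl , p0 , λ _ → ℕ.z≤n
search-least {suc n} P? {zero}  pi | no ¬p0 = ⊥-elim (¬p0 pi)
search-least {suc n} {P = P} P? {suc i} pi | no ¬p0 with search-least (P? ∘ suc) pi
... | j , found , pj , least = suc j , cong (Maybe.map suc) found , pj , least′
  where
  least′ : ∀ {i′} → P i′ → suc j Fin.≤ i′
  least′ {zero}   p0  = ⊥-elim (¬p0 p0)
  least′ {suc i′} pi′ = ℕ.s≤s (least pi′)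

module _ {n : ℕ} {_~_ : Rel (Fin n) ℓ} (_~?_ : Decidable₂ _~_) where

  classRep : Fin n → Fin n
  classRep i = fromMaybe i (search (i ~?_))

  classes : Part n
  classes = tabulate classRep

  module _ (~-equiv : IsEquivalence _~_) where
    open IsEquivalence ~-equiv renaming (refl to ~-refl; sym to ~-sym; trans to ~-trans)

    private
      rep-classes : ∀ i → rep classes i ≡ classRep i
      rep-classes = lookup∘tabulate classRep

      classRep-least : ∀ i → i ~ classRep i × (∀ {j} → i ~ j → classRep i Fin.≤ j)
      classRep-least i with search-least (i ~?_) (~-refl {i})
      ... | j , found , i~j , least rewrite found = i~j , least

      classRep-cong : ∀ {a b} → a ~ b → classRep a ≡ classRep b
      classRep-cong {a} {b} a~b =
        ≤-antisym (proj₂ (classRep-least a) (~-trans a~b (proj₁ (classRep-least b))))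
                  (proj₂ (classRep-least b) (~-trans (~-sym a~b) (proj₁ (classRep-least a))))

    classes-∼⁺ : ∀ {a b} → a ~ b → a ∼[ classes ] b
    classes-∼⁺ {a} {b} a~b = trans (rep-classes a) (trans (classRep-cong a~b) (sym (rep-classes b)))

    classes-∼⁻ : ∀ {a b} → a ∼[ classes ] b → a ~ b
    classes-∼⁻ {a} {b} a∼b = ~-trans (proj₁ (classRep-least a)) (subst (_~ b) (sym same) (~-sym (proj₁ (classRep-least b))))
      where
      same : classRep a ≡ classRep b
      same = trans (sym (rep-classes a)) (trans a∼b (rep-classes b))

    classes-canonical : IsCanonical classes
    classes-canonical i = subst (Fin._≤ i) (sym (rep-classes i)) (proj₂ (classRep-least i) ~-refl) ,
                          classes-∼⁺ (subst (_~ i) (sym (rep-classes i)) (~-sym (proj₁ (classRep-least i))))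

    classes-NC : (∀ a b c d → a Fin.< b → b Fin.< c → c Fin.< d → a ~ c → b ~ d → a ~ b) → classes ∈ NC n
    classes-NC nc = ∈-NC⁺ classes-canonical λ a b c d a<b b<c c<d a∼c b∼d →
      classes-∼⁺ (nc a b c d a<b b<c c<d (classes-∼⁻ a∼c) (classes-∼⁻ b∼d))

singletons : ∀ n → Part n
singletons n = tabulate id

singletons-∼ : {a b : Fin n} → a ∼[ singletons n ] b → a ≡ b
singletons-∼ {a = a} {b} a∼b = trans (sym (lookup∘tabulate id a)) (trans a∼b (lookup∘tabulate id b))

singletons-⊑ : (π : Part n) → singletons n ⊑ π
singletons-⊑ π a b a∼b = cong (rep π) (singletons-∼ a∼b)

singletons-NC : ∀ n → singletons n ∈ NC n
singletons-NC n = ∈-NC⁺ can λ a b c d a<b b<c _ a∼c _ → ⊥-elim (<-asym a<b (subst (b Fin.<_) (sym (singletons-∼ a∼c)) b<c))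
  where
  can : IsCanonical (singletons n)
  can i = subst (Fin._≤ i) (sym (lookup∘tabulate id i)) ≤-refl , cong (rep (singletons n)) (lookup∘tabulate id i)

one : ∀ n → Part (suc n)
one n = replicate (suc n) zero

rep-one : (i : Fin (suc n)) → rep (one n) i ≡ zero
rep-one i = lookup-replicate i zero

one-NC : ∀ n → one n ∈ NC (suc n)
one-NC n = ∈-NC⁺ can λ a b _ _ _ _ _ _ _ → trans (rep-one a) (sym (rep-one b))
  where
  can : IsCanonical (one n)
  can i = subst (Fin._≤ i) (sym (rep-one i)) ℕ.z≤n , trans (rep-one (rep (one n) i)) (sym (rep-one i))

-- The join in NC(n)

-- The helper of joinIsOne is bound in a where-block and cannot be named;
-- upperBoundᵇ is defined as the solution of the unification problem below,
-- which the with-generalisation makes a pattern problem.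
mutual
  upperBoundᵇ : Vec (Part n) k → ∀ {m} → Vec (Part n) m → Part n → Bool
  upperBoundᵇ = _

  private
    joinIsOne-∷ : (π : Part n) (πs : Vec (Part n) k) →
                  joinIsOne (π ∷ πs) ≡ allL (λ σ → not (refines π σ ∧ upperBoundᵇ (π ∷ πs) πs σ) ∨ isOne σ) (NC n)
    joinIsOne-∷ {k = k} π πs with suc k | π ∷ πs
    ... | _ | _ = refl

UpperBound : Vec (Part n) k → Part n → Set
UpperBound πs σ = ∀ i → lookup πs i ⊑ σ

JoinIsOne : Vec (Part n) k → Set
JoinIsOne {n} πs = ∀ σ → σ ∈ NC n → UpperBound πs σ → IsOne σ

upperBoundᵇ⁺ : (P : Vec (Part n) k) {m : ℕ} (πs : Vec (Part n) m) (σ : Part n) → UpperBound πs σ → T (upperBoundᵇ P πs σ)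
upperBoundᵇ⁺ P []       σ _  = tt
upperBoundᵇ⁺ P (π ∷ πs) σ ub = from T-∧ (refines⁺ π σ (ub zero) , upperBoundᵇ⁺ P πs σ (ub ∘ suc))

upperBoundᵇ⁻ : (P : Vec (Part n) k) {m : ℕ} (πs : Vec (Part n) m) (σ : Part n) → T (upperBoundᵇ P πs σ) → UpperBound πs σ
upperBoundᵇ⁻ P (π ∷ πs) σ t zero    = refines⁻ π σ (proj₁ (to T-∧ t))
upperBoundᵇ⁻ P (π ∷ πs) σ t (suc i) = upperBoundᵇ⁻ P πs σ (proj₂ (to T-∧ t)) i

joinIsOne⁺ : (πs : Vec (Part n) k) → JoinIsOne πs → T (joinIsOne πs)
joinIsOne⁺ {n} πs one = allL⁺ _ (NC n) λ {σ} σ∈ → T-⇒⁺ λ t → isOne⁺ σ (one σ σ∈ (upperBoundᵇ⁻ πs πs σ t))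

joinIsOne⁻ : (πs : Vec (Part n) k) → T (joinIsOne πs) → JoinIsOne πs
joinIsOne⁻ {n} πs t σ σ∈ ub = isOne⁻ σ (T-⇒⁻ (allL⁻ _ (NC n) t σ∈) (upperBoundᵇ⁺ πs πs σ ub))

module _ {n k : ℕ} (πs : Vec (Part n) k) where

  private
    JoinRel : Rel (Fin n) 0ℓ
    JoinRel a b = ∀ τ → τ ∈ NC n → UpperBound πs τ → a ∼[ τ ] b

    joinRel? : Decidable₂ JoinRel
    joinRel? a b = map′
      (λ t τ τ∈ ub → sameBlock⁻ τ (T-⇒⁻ (allL⁻ _ (NC n) t τ∈) (upperBoundᵇ⁺ πs πs τ ub)))
      (λ ∼τ → allL⁺ _ (NC n) λ {τ} τ∈ → T-⇒⁺ λ t → sameBlock⁺ τ (∼τ τ τ∈ (upperBoundᵇ⁻ πs πs τ t)))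
      (T? (allL (λ τ → not (upperBoundᵇ πs πs τ) ∨ sameBlock τ a b) (NC n)))

    joinRel-equiv : IsEquivalence JoinRel
    joinRel-equiv = record
      { refl  = λ _ _ _ → refl
      ; sym   = λ a~b τ τ∈ ub → sym (a~b τ τ∈ ub)
      ; trans = λ a~b b~c τ τ∈ ub → trans (a~b τ τ∈ ub) (b~c τ τ∈ ub)
      }

  join : Part n
  join = classes joinRel?

  join-NC : join ∈ NC n
  join-NC = classes-NC joinRel? joinRel-equiv λ a b c d a<b b<c c<d a~c b~d τ τ∈ ub →
    proj₂ (∈-NC⁻ τ∈) a b c d a<b b<c c<d (a~c τ τ∈ ub) (b~d τ τ∈ ub)

  join-upperBound : UpperBound πs join
  join-upperBound i a b a∼b = classes-∼⁺ joinRel? joinRel-equiv λ τ _ ub → ub i a b a∼b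

  join-least : ∀ τ → τ ∈ NC n → UpperBound πs τ → join ⊑ τ
  join-least τ τ∈ ub a b a∼b = classes-∼⁻ joinRel? joinRel-equiv a∼b τ τ∈ ub

  join-unique : ∀ σ → σ ∈ NC n → UpperBound πs σ → (∀ τ → τ ∈ NC n → UpperBound πs τ → σ ⊑ τ) → join ≡ σ
  join-unique σ σ∈ ub least = ⊑-antisym join σ (classes-canonical joinRel? joinRel-equiv) (proj₁ (∈-NC⁻ σ∈))
    (join-least σ σ∈ ub) (λ a b a∼b → classes-∼⁺ joinRel? joinRel-equiv λ τ τ∈ ub′ → least τ τ∈ ub′ a b a∼b)

-- Restriction to a block of σ, cutting it out, and gluing it back

lookup-AllPairs : {R : Rel A ℓ} {xs : List A} → AllPairs R xs → ∀ {i j} → i Fin.< j → R (List.lookup xs i) (List.lookup xs j)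
lookup-AllPairs {xs = x ∷ xs} (x<xs ∷ _)  {zero}  {suc j} _           = All.lookup x<xs (∈-lookup j)
lookup-AllPairs {xs = x ∷ xs} (_ ∷ xs<xs) {suc i} {suc j} (ℕ.s≤s i<j) = lookup-AllPairs xs<xs i<j

∼-equiv : (π : Part n) → IsEquivalence (_∼[ π ]_)
∼-equiv π = On.isEquivalence (rep π) ≡.isEquivalence

module _ {n : ℕ} (σ : Part n) where

  block : Fin n → List (Fin n)
  block r = filterᵇ (λ a → rep σ a ==F r) (allFin n)

  size : Fin n → ℕ
  size r = length (block r)

  embed : (r : Fin n) → Fin (size r) → Fin n
  embed r = List.lookup (block r)

  embed-∈ : ∀ r y → rep σ (embed r y) ≡ r
  embed-∈ r y = toWitness (proj₂ (∈-filter⁻ (T? ∘ λ a → rep σ a ==F r) {xs = allFin n} (∈-lookup {xs = block r} y)))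

  embed-< : ∀ r {y y′} → y Fin.< y′ → embed r y Fin.< embed r y′
  embed-< r = lookup-AllPairs {R = Fin._<_} (AllPairs.filter⁺ (T? ∘ λ a → rep σ a ==F r) (AllPairs.tabulate⁺-< {f = id} id))

  embed-≤ : ∀ r {y y′} → y Fin.≤ y′ → embed r y Fin.≤ embed r y′
  embed-≤ r y≤y′ with ℕ.m≤n⇒m<n∨m≡n y≤y′
  ... | inj₁ y<y′ = ℕ.<⇒≤ (embed-< r y<y′)
  ... | inj₂ y≡y′ = ≤-reflexive (cong (embed r) (toℕ-injective y≡y′))

  embed-<⁻ : ∀ r {y y′} → embed r y Fin.< embed r y′ → y Fin.< y′
  embed-<⁻ r {y} {y′} ey<ey′ with toℕ y ℕ.<? toℕ y′
  ... | yes y<y′ = y<y′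
  ... | no  y≮y′ = ⊥-elim (ℕ.<⇒≱ ey<ey′ (embed-≤ r (ℕ.≮⇒≥ y≮y′)))

  embed-injective : ∀ r {y y′} → embed r y ≡ embed r y′ → y ≡ y′
  embed-injective r {y} {y′} ey≡ey′ with <-cmp y y′
  ... | tri< y<y′ _ _ = ⊥-elim (<-irrefl ey≡ey′ (embed-< r y<y′))
  ... | tri≈ _ y≡y′ _ = y≡y′
  ... | tri> _ _ y>y′ = ⊥-elim (<-irrefl (sym ey≡ey′) (embed-< r y>y′))

  embed-surjective : ∀ r {a} → rep σ a ≡ r → ∃ λ y → embed r y ≡ a
  embed-surjective r {a} a∈r = Any.index a∈block , sym (lookup-index a∈block)
    where
    a∈block : a ∈ block r
    a∈block = ∈-filter⁺ (T? ∘ λ a → rep σ a ==F r) (∈-allFin _) (fromWitness a∈r)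

  filter-block : ∀ r {P : Pred (Fin n) ℓ} (P? : Decidable P) →
                 filter P? (block r) ≡ map (embed r) (filter (P? ∘ embed r) (allFin (size r)))
  filter-block r P? = trans (cong (filter P?) (sym map-embed)) (filter-map P? (embed r) (allFin (size r)))
    where
    map-embed : map (embed r) (allFin (size r)) ≡ block r
    map-embed = trans (map-tabulate id (embed r)) (tabulate-lookup (block r))

  data InBlock (r a : Fin n) : Set where
    inside  : ∀ y → embed r y ≡ a → InBlock r a
    outside : rep σ a ≢ r → InBlock r a

  inBlock : ∀ r a → InBlock r a
  inBlock r a with rep σ a ≟ r
  ... | yes a∈r = let y , ey≡a = embed-surjective r a∈r in inside y ey≡a
  ... | no  a∉r = outside a∉r

  data SameSide (r a a′ : Fin n) : Set where
    bothInside  : ∀ y y′ → embed r y ≡ a → embed r y′ ≡ a′ → SameSide r a a′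
    bothOutside : rep σ a ≢ r → rep σ a′ ≢ r → SameSide r a a′

  sameSide : ∀ r {a a′} → a ∼[ σ ] a′ → SameSide r a a′
  sameSide r {a} {a′} a∼a′ with inBlock r a | inBlock r a′
  ... | inside y e    | inside y′ e′ = bothInside y y′ e e′
  ... | inside y refl | outside a′∉r = ⊥-elim (a′∉r (trans (sym a∼a′) (embed-∈ r y)))
  ... | outside a∉r   | inside y′ refl = ⊥-elim (a∉r (trans a∼a′ (embed-∈ r y′)))
  ... | outside a∉r   | outside a′∉r = bothOutside a∉r a′∉r

  outside-other : ∀ {r r′} → r′ ≢ r → ∀ y → rep σ (embed r′ y) ≢ r
  outside-other r′≢r y e = r′≢r (trans (sym (embed-∈ _ y)) e)

  restrict : (r : Fin n) → Part n → Part (size r)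
  restrict r π = classes (λ y y′ → rep π (embed r y) ≟ rep π (embed r y′))

  module _ (r : Fin n) (π : Part n) where

    private
      restrict-equiv : IsEquivalence (λ y y′ → embed r y ∼[ π ] embed r y′)
      restrict-equiv = On.isEquivalence (embed r) (∼-equiv π)

    restrict-∼⁺ : ∀ {y y′} → embed r y ∼[ π ] embed r y′ → y ∼[ restrict r π ] y′
    restrict-∼⁺ = classes-∼⁺ _ restrict-equiv

    restrict-∼⁻ : ∀ {y y′} → y ∼[ restrict r π ] y′ → embed r y ∼[ π ] embed r y′
    restrict-∼⁻ = classes-∼⁻ _ restrict-equiv

    restrict-canonical : IsCanonical (restrict r π)
    restrict-canonical = classes-canonical _ restrict-equiv

    restrict-NC : Noncrossing π → restrict r π ∈ NC (size r)
    restrict-NC π-nc = classes-NC _ restrict-equiv λ a b c d a<b b<c c<d →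
      π-nc (embed r a) (embed r b) (embed r c) (embed r d) (embed-< r a<b) (embed-< r b<c) (embed-< r c<d)

    embed-rep : IsCanonical π → π ⊑ σ → ∀ y → embed r (rep (restrict r π) y) ≡ rep π (embed r y)
    embed-rep π-can π⊑σ y = ≤-antisym upper lower
      where
      ρ : Part (size r)
      ρ = restrict r π
      μ : Fin n
      μ = rep π (embed r y)
      ey∼μ : embed r y ∼[ π ] μ
      ey∼μ = rep-∼ π π-can (embed r y)
      μ∈r : rep σ μ ≡ r
      μ∈r = trans (sym (π⊑σ _ _ ey∼μ)) (embed-∈ r y)
      upper : embed r (rep ρ y) Fin.≤ μ
      upper with embed-surjective r μ∈r
      ... | z , ez≡μ = subst (embed r (rep ρ y) Fin.≤_) ez≡μ
                         (embed-≤ r (rep-least ρ restrict-canonical (restrict-∼⁺ (trans ey∼μ (cong (rep π) (sym ez≡μ))))))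
      lower : μ Fin.≤ embed r (rep ρ y)
      lower = rep-least π π-can (restrict-∼⁻ (rep-∼ ρ restrict-canonical y))

    rep-restrict⁺ : IsCanonical π → π ⊑ σ → ∀ {y y′} → rep π (embed r y′) ≡ embed r y → rep (restrict r π) y′ ≡ y
    rep-restrict⁺ π-can π⊑σ {y} {y′} e = embed-injective r (trans (embed-rep π-can π⊑σ y′) e)

    rep-restrict⁻ : IsCanonical π → π ⊑ σ → ∀ {y y′} → rep (restrict r π) y′ ≡ y → rep π (embed r y′) ≡ embed r y
    rep-restrict⁻ π-can π⊑σ {y} {y′} e = trans (sym (embed-rep π-can π⊑σ y′)) (cong (embed r) e)

  -- A partition π ⊑ σ splits into cut r π (π with the block r of σ broken into
  -- singletons) and restrict r π (π on that block); glue undoes the split.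
  CutRel : Fin n → Part n → Rel (Fin n) 0ℓ
  CutRel r π a a′ = a ≡ a′ ⊎ (rep σ a ≢ r × rep σ a′ ≢ r × a ∼[ π ] a′)

  cut : Fin n → Part n → Part n
  cut r π = classes (λ a a′ → (a ≟ a′) ⊎-dec (¬? (rep σ a ≟ r) ×-dec ¬? (rep σ a′ ≟ r) ×-dec (rep π a ≟ rep π a′)))

  module _ (r : Fin n) (π : Part n) where

    private
      cut-equiv : IsEquivalence (CutRel r π)
      cut-equiv = record
        { refl  = inj₁ refl
        ; sym   = λ { (inj₁ a≡a′) → inj₁ (sym a≡a′) ; (inj₂ (a∉ , a′∉ , a∼a′)) → inj₂ (a′∉ , a∉ , sym a∼a′) }
        ; trans = λ { (inj₁ refl) a′~a″ → a′~a″
                    ; a~a′ (inj₁ refl) → a~a′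
                    ; (inj₂ (a∉ , _ , a∼a′)) (inj₂ (_ , a″∉ , a′∼a″)) → inj₂ (a∉ , a″∉ , trans a∼a′ a′∼a″) }
        }

    cut-∼⁺ : ∀ {a a′} → rep σ a ≢ r → rep σ a′ ≢ r → a ∼[ π ] a′ → a ∼[ cut r π ] a′
    cut-∼⁺ a∉ a′∉ a∼a′ = classes-∼⁺ _ cut-equiv (inj₂ (a∉ , a′∉ , a∼a′))

    cut-∼⁻ : ∀ {a a′} → a ∼[ cut r π ] a′ → CutRel r π a a′
    cut-∼⁻ = classes-∼⁻ _ cut-equiv

    cut-canonical : IsCanonical (cut r π)
    cut-canonical = classes-canonical _ cut-equiv

    cut-⊑ : π ⊑ σ → cut r π ⊑ σ
    cut-⊑ π⊑σ a a′ a∼a′ with cut-∼⁻ a∼a′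
    ... | inj₁ refl = refl
    ... | inj₂ (_ , _ , a∼a′) = π⊑σ a a′ a∼a′

    cut-NC : Noncrossing π → cut r π ∈ NC n
    cut-NC π-nc = classes-NC _ cut-equiv nc
      where
      nc : ∀ a b c d → a Fin.< b → b Fin.< c → c Fin.< d → CutRel r π a c → CutRel r π b d → CutRel r π a b
      nc a b c d a<b b<c c<d (inj₁ refl) _ = ⊥-elim (ℕ.<-asym a<b b<c)
      nc a b c d a<b b<c c<d _ (inj₁ refl) = ⊥-elim (ℕ.<-asym b<c c<d)
      nc a b c d a<b b<c c<d (inj₂ (a∉ , _ , a∼c)) (inj₂ (b∉ , _ , b∼d)) = inj₂ (a∉ , b∉ , π-nc a b c d a<b b<c c<d a∼c b∼d)

  data GlueRel (r : Fin n) (π : Part n) (ρ : Part (size r)) (a a′ : Fin n) : Set where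
    inside  : ∀ {y y′} → embed r y ≡ a → embed r y′ ≡ a′ → y ∼[ ρ ] y′ → GlueRel r π ρ a a′
    outside : rep σ a ≢ r → rep σ a′ ≢ r → a ∼[ π ] a′ → GlueRel r π ρ a a′

  module _ (r : Fin n) (π : Part n) (ρ : Part (size r)) where

    glueRel-inside : ∀ {y y′} → GlueRel r π ρ (embed r y) (embed r y′) → y ∼[ ρ ] y′
    glueRel-inside (inside e e′ z∼z′) rewrite embed-injective r e | embed-injective r e′ = z∼z′
    glueRel-inside (outside ey∉ _ _) = ⊥-elim (ey∉ (embed-∈ r _))

    glueRel-outside : ∀ {a a′} → rep σ a ≢ r → GlueRel r π ρ a a′ → a ∼[ π ] a′
    glueRel-outside a∉ (inside refl _ _) = ⊥-elim (a∉ (embed-∈ r _))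
    glueRel-outside _  (outside _ _ a∼a′) = a∼a′

    glueRel-⊑ : π ⊑ σ → ∀ {a a′} → GlueRel r π ρ a a′ → a ∼[ σ ] a′
    glueRel-⊑ _   (inside refl refl _) = trans (embed-∈ r _) (sym (embed-∈ r _))
    glueRel-⊑ π⊑σ (outside _ _ a∼a′) = π⊑σ _ _ a∼a′

    glueRel? : Decidable₂ (GlueRel r π ρ)
    glueRel? a a′ with inBlock r a | inBlock r a′
    ... | inside y refl | inside y′ refl = map′ (inside refl refl) glueRel-inside (rep ρ y ≟ rep ρ y′)
    ... | outside a∉    | outside a′∉    = map′ (outside a∉ a′∉) (glueRel-outside a∉) (rep π a ≟ rep π a′)
    ... | inside y refl | outside a′∉    = no λ where
      (inside _ refl _)   → a′∉ (embed-∈ r _)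
      (outside ey∉ _ _)   → ey∉ (embed-∈ r y)
    ... | outside a∉    | inside y′ refl = no λ where
      (inside refl _ _)   → a∉ (embed-∈ r _)
      (outside _ ey′∉ _)  → ey′∉ (embed-∈ r y′)

    private
      glue-equiv : IsEquivalence (GlueRel r π ρ)
      glue-equiv = record { refl = refl′ ; sym = sym′ ; trans = trans′ }
        where
        refl′ : ∀ {a} → GlueRel r π ρ a a
        refl′ {a} with inBlock r a
        ... | inside y ey≡a = inside ey≡a ey≡a refl
        ... | outside a∉    = outside a∉ a∉ refl
        sym′ : ∀ {a a′} → GlueRel r π ρ a a′ → GlueRel r π ρ a′ a
        sym′ (inside e e′ y∼y′)     = inside e′ e (sym y∼y′)
        sym′ (outside a∉ a′∉ a∼a′) = outside a′∉ a∉ (sym a∼a′)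
        trans′ : ∀ {a b c} → GlueRel r π ρ a b → GlueRel r π ρ b c → GlueRel r π ρ a c
        trans′ (inside ea eb ya∼yb) (inside eb′ ec yb′∼yc) =
          inside ea ec (trans ya∼yb (subst (λ y → y ∼[ ρ ] _) (embed-injective r (trans eb′ (sym eb))) yb′∼yc))
        trans′ (outside a∉ _ a∼b) (outside _ c∉ b∼c) = outside a∉ c∉ (trans a∼b b∼c)
        trans′ (inside _ refl _) (outside eb∉ _ _) = ⊥-elim (eb∉ (embed-∈ r _))
        trans′ (outside _ eb∉ _) (inside refl _ _) = ⊥-elim (eb∉ (embed-∈ r _))

    glue : Part n
    glue = classes glueRel?

    glue-∼⁺ : ∀ {a a′} → GlueRel r π ρ a a′ → a ∼[ glue ] a′
    glue-∼⁺ = classes-∼⁺ glueRel? glue-equiv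

    glue-∼⁻ : ∀ {a a′} → a ∼[ glue ] a′ → GlueRel r π ρ a a′
    glue-∼⁻ = classes-∼⁻ glueRel? glue-equiv

    glue-canonical : IsCanonical glue
    glue-canonical = classes-canonical glueRel? glue-equiv

    glue-⊑ : π ⊑ σ → glue ⊑ σ
    glue-⊑ π⊑σ a a′ = glueRel-⊑ π⊑σ ∘ glue-∼⁻

    glue-NC : Noncrossing σ → Noncrossing π → π ⊑ σ → ρ ∈ NC (size r) → glue ∈ NC n
    glue-NC σ-nc π-nc π⊑σ ρ∈ = classes-NC glueRel? glue-equiv nc
      where
      ρ-nc : Noncrossing ρ
      ρ-nc = proj₂ (∈-NC⁻ ρ∈)
      nc : ∀ a b c d → a Fin.< b → b Fin.< c → c Fin.< d → GlueRel r π ρ a c → GlueRel r π ρ b d → GlueRel r π ρ a b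
      nc a b c d a<b b<c c<d (inside refl refl ya∼yc) (inside refl refl yb∼yd) =
        inside refl refl (ρ-nc _ _ _ _ (embed-<⁻ r a<b) (embed-<⁻ r b<c) (embed-<⁻ r c<d) ya∼yc yb∼yd)
      nc a b c d a<b b<c c<d (outside a∉ _ a∼c) (outside b∉ _ b∼d) = outside a∉ b∉ (π-nc a b c d a<b b<c c<d a∼c b∼d)
      nc a b c d a<b b<c c<d g@(inside refl refl _) g′@(outside b∉ _ _) =
        ⊥-elim (b∉ (trans (sym (σ-nc a b c d a<b b<c c<d (glueRel-⊑ π⊑σ g) (glueRel-⊑ π⊑σ g′))) (embed-∈ r _)))
      nc a b c d a<b b<c c<d g@(outside a∉ _ _) g′@(inside refl refl _) =
        ⊥-elim (a∉ (trans (σ-nc a b c d a<b b<c c<d (glueRel-⊑ π⊑σ g) (glueRel-⊑ π⊑σ g′)) (embed-∈ r _)))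

  glue-cut-restrict : ∀ r {π} → IsCanonical π → π ⊑ σ → glue r (cut r π) (restrict r π) ≡ π
  glue-cut-restrict r {π} π-can π⊑σ = ⊑-antisym _ π (glue-canonical r (cut r π) (restrict r π)) π-can glued⊑π π⊑glued
    where
    glued⊑π : glue r (cut r π) (restrict r π) ⊑ π
    glued⊑π a a′ a∼a′ with glue-∼⁻ r (cut r π) (restrict r π) a∼a′
    ... | inside refl refl y∼y′ = restrict-∼⁻ r π y∼y′
    ... | outside _ _ a∼a′ with cut-∼⁻ r π a∼a′
    ...   | inj₁ refl = refl
    ...   | inj₂ (_ , _ , a∼a′) = a∼a′
    π⊑glued : π ⊑ glue r (cut r π) (restrict r π)
    π⊑glued a a′ a∼a′ with sameSide r (π⊑σ a a′ a∼a′)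
    ... | bothInside y y′ refl refl = glue-∼⁺ r (cut r π) (restrict r π) (inside refl refl (restrict-∼⁺ r π a∼a′))
    ... | bothOutside a∉ a′∉ = glue-∼⁺ r (cut r π) (restrict r π) (outside a∉ a′∉ (cut-∼⁺ r π a∉ a′∉ a∼a′))

  cut-glue : ∀ r {π} ρ → IsCanonical π → (∀ {a a′} → rep σ a ≡ r → a ∼[ π ] a′ → a ≡ a′) → cut r (glue r π ρ) ≡ π
  cut-glue r {π} ρ π-can trivial = ⊑-antisym _ π (cut-canonical r (glue r π ρ)) π-can cut⊑π π⊑cut
    where
    cut⊑π : cut r (glue r π ρ) ⊑ π
    cut⊑π a a′ a∼a′ with cut-∼⁻ r (glue r π ρ) a∼a′
    ... | inj₁ refl = refl
    ... | inj₂ (a∉ , _ , a∼a′) = glueRel-outside r π ρ a∉ (glue-∼⁻ r π ρ a∼a′)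
    π⊑cut : π ⊑ cut r (glue r π ρ)
    π⊑cut a a′ a∼a′ with rep σ a ≟ r | rep σ a′ ≟ r
    ... | yes a∈  | _        = cong (rep (cut r (glue r π ρ))) (trivial a∈ a∼a′)
    ... | no _    | yes a′∈  = cong (rep (cut r (glue r π ρ))) (sym (trivial a′∈ (sym a∼a′)))
    ... | no a∉   | no a′∉   = cut-∼⁺ r (glue r π ρ) a∉ a′∉ (glue-∼⁺ r π ρ (outside a∉ a′∉ a∼a′))

  restrict-glue : ∀ r π {ρ} → IsCanonical ρ → restrict r (glue r π ρ) ≡ ρ
  restrict-glue r π {ρ} ρ-can = ⊑-antisym _ ρ (restrict-canonical r (glue r π ρ)) ρ-can
    (λ y y′ → glueRel-inside r π ρ ∘ glue-∼⁻ r π ρ ∘ restrict-∼⁻ r (glue r π ρ))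
    (λ y y′ → restrict-∼⁺ r (glue r π ρ) ∘ glue-∼⁺ r π ρ ∘ inside refl refl)

  restrict-glue-other : ∀ {r r′} → r′ ≢ r → ∀ π ρ → restrict r′ (glue r π ρ) ≡ restrict r′ π
  restrict-glue-other {r} {r′} r′≢r π ρ = ⊑-antisym _ _ (restrict-canonical r′ (glue r π ρ)) (restrict-canonical r′ π)
    (λ y y′ → restrict-∼⁺ r′ π ∘ glueRel-outside r π ρ (outside-other r′≢r y) ∘ glue-∼⁻ r π ρ ∘ restrict-∼⁻ r′ (glue r π ρ))
    (λ y y′ → restrict-∼⁺ r′ (glue r π ρ) ∘ glue-∼⁺ r π ρ ∘ outside (outside-other r′≢r y) (outside-other r′≢r y′) ∘ restrict-∼⁻ r′ π)

  restrict-cut-other : ∀ {r r′} → r′ ≢ r → ∀ π → restrict r′ (cut r π) ≡ restrict r′ π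
  restrict-cut-other {r} {r′} r′≢r π = ⊑-antisym _ _ (restrict-canonical r′ (cut r π)) (restrict-canonical r′ π) cut⊑ ⊑cut
    where
    cut⊑ : restrict r′ (cut r π) ⊑ restrict r′ π
    cut⊑ y y′ y∼y′ with cut-∼⁻ r π (restrict-∼⁻ r′ (cut r π) y∼y′)
    ... | inj₁ e = restrict-∼⁺ r′ π (cong (rep π) e)
    ... | inj₂ (_ , _ , ey∼ey′) = restrict-∼⁺ r′ π ey∼ey′
    ⊑cut : restrict r′ π ⊑ restrict r′ (cut r π)
    ⊑cut y y′ = restrict-∼⁺ r′ (cut r π) ∘ cut-∼⁺ r π (outside-other r′≢r y) (outside-other r′≢r y′) ∘ restrict-∼⁻ r′ π

-- Multiplicativity of multPart over the blocks of σ

isRep? : (π : Part n) → Decidable (λ i → T (rep π i ==F i))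
isRep? π = T? ∘ λ i → rep π i ==F i

representatives : Part n → List (Fin n)
representatives {n} π = filterᵇ (λ i → rep π i ==F i) (allFin n)

representatives-unique : (π : Part n) → Unique (representatives π)
representatives-unique {n} π = Unique.filter⁺ (isRep? π) (Unique.allFin⁺ n)

∈-representatives⁺ : (π : Part n) {i : Fin n} → rep π i ≡ i → i ∈ representatives π
∈-representatives⁺ π i-rep = ∈-filter⁺ (isRep? π) (∈-allFin _) (fromWitness i-rep)

∈-representatives⁻ : (π : Part n) {i : Fin n} → i ∈ representatives π → rep π i ≡ i
∈-representatives⁻ {n} π i∈ = toWitness (proj₂ (∈-filter⁻ (isRep? π) {xs = allFin n} i∈))

module _ {n : ℕ} (σ : Part n) where

  private
    ∈block? : (r : Fin n) → Decidable (λ a → T (rep σ a ==F r))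
    ∈block? r = T? ∘ λ a → rep σ a ==F r

  representatives-restrict : ∀ r π → IsCanonical π → π ⊑ σ →
    filter (λ i → rep σ i ≟ r) (representatives π) ≡ map (embed σ r) (representatives (restrict σ r π))
  representatives-restrict r π π-can π⊑σ = begin
    filter (λ i → rep σ i ≟ r) (filter (isRep? π) (allFin n))
      ≡⟨ filter-filter (λ i → rep σ i ≟ r) (isRep? π) (allFin n) ⟩
    filter ((λ i → rep σ i ≟ r) ∩? isRep? π) (allFin n)
      ≡⟨ filter-≐ _ (isRep? π ∩? ∈block? r) ((λ (i∈ , i-rep) → i-rep , fromWitness i∈) , (λ (i-rep , i∈) → toWitness i∈ , i-rep)) (allFin n) ⟩
    filter (isRep? π ∩? ∈block? r) (allFin n)
      ≡⟨ filter-filter (isRep? π) (∈block? r) (allFin n) ⟨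
    filter (isRep? π) (block σ r)
      ≡⟨ filter-block σ r (isRep? π) ⟩
    map (embed σ r) (filter (isRep? π ∘ embed σ r) (allFin (size σ r)))
      ≡⟨ cong (map (embed σ r)) (filter-≐ (isRep? π ∘ embed σ r) (isRep? ρ) (fromWitness ∘ rep-restrict⁺ σ r π π-can π⊑σ ∘ toWitness , fromWitness ∘ rep-restrict⁻ σ r π π-can π⊑σ ∘ toWitness) (allFin (size σ r))) ⟩
    map (embed σ r) (representatives ρ) ∎
    where
    open ≡-Reasoning
    ρ : Part (size σ r)
    ρ = restrict σ r π

  blockSize-restrict : ∀ r π → IsCanonical π → π ⊑ σ → ∀ y → blockSize π (embed σ r y) ≡ blockSize (restrict σ r π) y
  blockSize-restrict r π π-can π⊑σ y = begin
    length (filter P? (allFin n))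
      ≡⟨ cong length (filter-≐ P? (P? ∩? ∈block? r) ((λ p → p , fromWitness (in-block (toWitness p))) , proj₁) (allFin n)) ⟩
    length (filter (P? ∩? ∈block? r) (allFin n))
      ≡⟨ cong length (filter-filter P? (∈block? r) (allFin n)) ⟨
    length (filter P? (block σ r))
      ≡⟨ cong length (filter-block σ r P?) ⟩
    length (map (embed σ r) (filter (P? ∘ embed σ r) (allFin (size σ r))))
      ≡⟨ length-map (embed σ r) (filter (P? ∘ embed σ r) (allFin (size σ r))) ⟩
    length (filter (P? ∘ embed σ r) (allFin (size σ r)))
      ≡⟨ cong length (filter-≐ (P? ∘ embed σ r) (T? ∘ λ y′ → rep ρ y′ ==F y) (fromWitness ∘ rep-restrict⁺ σ r π π-can π⊑σ ∘ toWitness , fromWitness ∘ rep-restrict⁻ σ r π π-can π⊑σ ∘ toWitness) (allFin (size σ r))) ⟩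
    length (filter (T? ∘ λ y′ → rep ρ y′ ==F y) (allFin (size σ r))) ∎
    where
    open ≡-Reasoning
    ρ : Part (size σ r)
    ρ = restrict σ r π
    P? : Decidable (λ j → T (rep π j ==F embed σ r y))
    P? = T? ∘ λ j → rep π j ==F embed σ r y
    in-block : ∀ {j} → rep π j ≡ embed σ r y → rep σ j ≡ r
    in-block {j} e = trans (π⊑σ j (embed σ r y) (trans e (sym ey-rep))) (embed-∈ σ r y)
      where
      ey-rep : rep π (embed σ r y) ≡ embed σ r y
      ey-rep = subst (λ z → rep π z ≡ z) e (proj₂ (π-can j))

module _ {c ℓ} (A : CommutativeRing c ℓ) where
  open CommutativeRing A hiding (zero) renaming (refl to ≈-refl; sym to ≈-sym; trans to ≈-trans; reflexive to ≈-reflexive)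
  open BigOperators A

  multPart-restrict : (T : ℕ → Carrier) {σ π : Part n} → IsCanonical σ → IsCanonical π → π ⊑ σ →
    multPart A T π ≈ ∏ (λ r → multPart A T (restrict σ r π)) (representatives σ)
  multPart-restrict T {σ} {π} σ-can π-can π⊑σ =
    ≈-trans (∏-fibres _≟_ (T ∘ blockSize π) (rep σ) (representatives π) (representatives-unique σ)
                      (λ {i} _ → ∈-representatives⁺ σ (proj₂ (σ-can i))))
            (∏-cong (representatives σ) (λ {r} _ → fibre r))
    where
    open import Relation.Binary.Reasoning.Setoid setoid
    fibre : ∀ r → ∏ (T ∘ blockSize π) (filter (λ i → rep σ i ≟ r) (representatives π)) ≈ multPart A T (restrict σ r π)
    fibre r = begin
      ∏ (T ∘ blockSize π) (filter (λ i → rep σ i ≟ r) (representatives π))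
        ≡⟨ cong (∏ (T ∘ blockSize π)) (representatives-restrict σ r π π-can π⊑σ) ⟩
      ∏ (T ∘ blockSize π) (map (embed σ r) (representatives (restrict σ r π)))
        ≡⟨ ∏-map (T ∘ blockSize π) (embed σ r) (representatives (restrict σ r π)) ⟩
      ∏ (T ∘ blockSize π ∘ embed σ r) (representatives (restrict σ r π))
        ≈⟨ ∏-cong (representatives (restrict σ r π)) (λ {y} _ → ≈-reflexive (cong T (blockSize-restrict σ r π π-can π⊑σ y))) ⟩
      ∏ (T ∘ blockSize (restrict σ r π)) (representatives (restrict σ r π)) ∎

-- Free cumulants are determined by the moments

_≟ₚ_ : DecidableEquality (Part n)
_≟ₚ_ = Vec.≡-dec _≟_

blockSize-positive : (π : Part n) {i : Fin n} → rep π i ≡ i → 1 ≤ blockSize π i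
blockSize-positive {n} π {i} i-rep = filter-some (T? ∘ λ j → rep π j ==F i) (lose (∈-allFin i) (fromWitness i-rep))

blockSize-< : (π : Part (suc n)) → IsCanonical π → π ≢ one n → ∀ i → blockSize π i < suc n
blockSize-< {n} π π-can π≢one i = ℕ.≤∧≢⇒< blockSize-≤ λ full → π≢one (lookup-ext (all-in-block full))
  where
  P? : Decidable (λ j → T (rep π j ==F i))
  P? = T? ∘ λ j → rep π j ==F i
  blockSize-≤ : blockSize π i ≤ suc n
  blockSize-≤ = subst (blockSize π i ≤_) (length-tabulate id) (length-filter P? (allFin (suc n)))
  all-in-block : blockSize π i ≡ suc n → ∀ j → rep π j ≡ rep (one n) j
  all-in-block full j = trans (in-block j) (trans i≡0 (sym (rep-one j)))
    where
    everything : filter P? (allFin (suc n)) ≡ allFin (suc n)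
    everything = filter-complete P? (trans full (sym (length-tabulate id)))
    in-block : ∀ j → rep π j ≡ i
    in-block j = toWitness (proj₂ (∈-filter⁻ P? (subst (j ∈_) (sym everything) (∈-allFin j))))
    i≡0 : i ≡ zero
    i≡0 = trans (sym (in-block zero)) (toℕ-injective (ℕ.n≤0⇒n≡0 (proj₁ (π-can zero))))

representatives-one : representatives (one n) ≡ [ zero ]
representatives-one {n} = filter-unique (isRep? (one n)) (Unique.allFin⁺ (suc n)) (∈-allFin zero) (fromWitness {a? = rep (one n) zero ≟ zero} (rep-one zero))
  (λ {y} _ y-rep → trans (sym (toWitness y-rep)) (rep-one y))

blockSize-one : blockSize (one n) zero ≡ suc n
blockSize-one {n} = trans (cong length (filter-all (T? ∘ λ j → rep (one n) j ==F zero) (All.universal (fromWitness ∘ rep-one) (allFin (suc n)))))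
                          (length-tabulate {n = suc n} id)

module _ {c ℓ} (A : CommutativeRing c ℓ) where
  open CommutativeRing A hiding (zero) renaming (refl to ≈-refl; sym to ≈-sym; trans to ≈-trans; reflexive to ≈-reflexive)
  open BigOperators A
  open import Algebra.Properties.Group +-group using (∙-cancelʳ)
  open import Relation.Binary.Reasoning.Setoid setoid

  multPart-one : (X : ℕ → Carrier) → multPart A X (one n) ≈ X (suc n)
  multPart-one {n} X = begin
    ∏ (X ∘ blockSize (one n)) (representatives (one n)) ≡⟨ cong (∏ (X ∘ blockSize (one n))) representatives-one ⟩
    X (blockSize (one n) zero) * 1#                      ≈⟨ *-identityʳ _ ⟩
    X (blockSize (one n) zero)                           ≡⟨ cong X blockSize-one ⟩
    X (suc n)                                            ∎

  free-cumulants-unique : (X Y : ℕ → Carrier) →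
    (∀ m → 1 ≤ m → ∑ (multPart A X) (NC m) ≈ ∑ (multPart A Y) (NC m)) → ∀ n → 1 ≤ n → X n ≈ Y n
  free-cumulants-unique X Y same-moments = <-rec (λ n → 1 ≤ n → X n ≈ Y n) step
    where
    step : ∀ n → (∀ {m} → m < n → 1 ≤ m → X m ≈ Y m) → 1 ≤ n → X n ≈ Y n
    step (suc n) X≈Y<n _ = ∙-cancelʳ (∑ (multPart A Y) lower) _ _ (begin
      X (suc n) + ∑ (multPart A Y) lower      ≈⟨ +-cong (≈-sym (multPart-one X)) (≈-sym lower-agree) ⟩
      multPart A X (one n) + ∑ (multPart A X) lower
        ≈⟨ ∑-remove _≟ₚ_ (multPart A X) (NC-unique (suc n)) (one-NC n) ⟨
      ∑ (multPart A X) (NC (suc n))           ≈⟨ same-moments (suc n) (ℕ.s≤s ℕ.z≤n) ⟩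
      ∑ (multPart A Y) (NC (suc n))           ≈⟨ ∑-remove _≟ₚ_ (multPart A Y) (NC-unique (suc n)) (one-NC n) ⟩
      multPart A Y (one n) + ∑ (multPart A Y) lower ≈⟨ +-cong (multPart-one Y) ≈-refl ⟩
      Y (suc n) + ∑ (multPart A Y) lower      ∎)
      where
      lower : List (Part (suc n))
      lower = filter (λ π → ¬? (π ≟ₚ one n)) (NC (suc n))
      lower-agree : ∑ (multPart A X) lower ≈ ∑ (multPart A Y) lower
      lower-agree = ∑-cong lower λ {π} π∈ →
        let π∈NC , π≢one = ∈-filter⁻ (λ π → ¬? (π ≟ₚ one n)) {xs = NC (suc n)} π∈ in
        ∏-cong (representatives π) λ {i} i∈ →
          X≈Y<n (blockSize-< π (proj₁ (∈-NC⁻ π∈NC)) π≢one i) (blockSize-positive π (∈-representatives⁻ π i∈))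

-- Tuples with a given join

joinOneTuples : (k m : ℕ) → List (Vec (Part m) k)
joinOneTuples k m = filterᵇ joinIsOne (tuples (NC m) k)

joinOneTuples-unique : Unique (joinOneTuples k m)
joinOneTuples-unique {k} {m} = Unique.filter⁺ (T? ∘ joinIsOne) (tuples-unique k (NC-unique m))

∈-joinOneTuples⁺ : {ρs : Vec (Part m) k} → (∀ i → lookup ρs i ∈ NC m) → T (joinIsOne ρs) → ρs ∈ joinOneTuples k m
∈-joinOneTuples⁺ ρs∈ j = ∈-filter⁺ (T? ∘ joinIsOne) (∈-tuples⁺ ρs∈) j

∈-joinOneTuples⁻ : {ρs : Vec (Part m) k} → ρs ∈ joinOneTuples k m → (∀ i → lookup ρs i ∈ NC m) × T (joinIsOne ρs)
∈-joinOneTuples⁻ {m} {k} ρs∈ with ∈-filter⁻ (T? ∘ joinIsOne) {xs = tuples (NC m) k} ρs∈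
... | ρs∈tuples , j = ∈-tuples⁻ ρs∈tuples , j

module _ {n : ℕ} (σ : Part n) where

  Supported : List (Fin n) → Part n → Set
  Supported S π = ∀ a a′ → a ∼[ π ] a′ → a ≡ a′ ⊎ rep σ a ∈ S

  supported-cut : ∀ {r S π} → Supported (r ∷ S) π → Supported S (cut σ r π)
  supported-cut {r} {S} {π} π-supp a a′ a∼a′ with cut-∼⁻ σ r π a∼a′
  ... | inj₁ a≡a′ = inj₁ a≡a′
  ... | inj₂ (a∉r , _ , a∼a′) with π-supp a a′ a∼a′
  ...   | inj₁ a≡a′       = inj₁ a≡a′
  ...   | inj₂ (here a∈r)  = ⊥-elim (a∉r a∈r)
  ...   | inj₂ (there a∈S) = inj₂ a∈S

  supported-glue : ∀ {r S π ρ} → Supported S π → Supported (r ∷ S) (glue σ r π ρ)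
  supported-glue {r} {S} {π} {ρ} π-supp a a′ a∼a′ with glue-∼⁻ σ r π ρ a∼a′
  ... | inside refl _ _    = inj₂ (here (embed-∈ σ r _))
  ... | outside _ _ a∼a′ with π-supp a a′ a∼a′
  ...   | inj₁ a≡a′ = inj₁ a≡a′
  ...   | inj₂ a∈S  = inj₂ (there a∈S)

  supported-trivial : ∀ {r S π} → All (r ≢_) S → Supported S π → ∀ {a a′} → rep σ a ≡ r → a ∼[ π ] a′ → a ≡ a′
  supported-trivial r∉S π-supp {a} {a′} a∈r a∼a′ with π-supp a a′ a∼a′
  ... | inj₁ a≡a′ = a≡a′
  ... | inj₂ a∈S  = ⊥-elim (All.lookup r∉S a∈S (sym a∈r))

  restrictAll : (r : Fin n) → Vec (Part n) k → Vec (Part (size σ r)) k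
  restrictAll r = Vec.map (restrict σ r)

  cutAll : Fin n → Vec (Part n) k → Vec (Part n) k
  cutAll r = Vec.map (cut σ r)

  glueAll : (r : Fin n) → Vec (Part n) k → Vec (Part (size σ r)) k → Vec (Part n) k
  glueAll r = zipWith (glue σ r)

  restrictAll-cutAll-other : ∀ {r r′} → r′ ≢ r → (πs : Vec (Part n) k) → restrictAll r′ (cutAll r πs) ≡ restrictAll r′ πs
  restrictAll-cutAll-other {r = r} {r′} r′≢r πs =
    trans (sym (map-∘ (restrict σ r′) (cut σ r) πs)) (map-cong (restrict-cut-other σ r′≢r) πs)

  restrictAll-glueAll-other : ∀ {r r′} → r′ ≢ r → (πs : Vec (Part n) k) (ρs : Vec (Part (size σ r)) k) → restrictAll r′ (glueAll r πs ρs) ≡ restrictAll r′ πs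
  restrictAll-glueAll-other {r = r} {r′} r′≢r πs ρs = lookup-ext λ i → begin
    lookup (restrictAll r′ (glueAll r πs ρs)) i        ≡⟨ lookup-map i _ (glueAll r πs ρs) ⟩
    restrict σ r′ (lookup (glueAll r πs ρs) i)          ≡⟨ cong (restrict σ r′) (lookup-zipWith _ i πs ρs) ⟩
    restrict σ r′ (glue σ r (lookup πs i) (lookup ρs i)) ≡⟨ restrict-glue-other σ r′≢r _ _ ⟩
    restrict σ r′ (lookup πs i)                          ≡⟨ lookup-map i _ πs ⟨
    lookup (restrictAll r′ πs) i                         ∎
    where open ≡-Reasoning

  restrictAll-glueAll : ∀ r (πs : Vec (Part n) k) {ρs} → (∀ i → IsCanonical (lookup ρs i)) → restrictAll r (glueAll r πs ρs) ≡ ρs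
  restrictAll-glueAll r πs {ρs} ρs-can = lookup-ext λ i →
    trans (lookup-map i _ (glueAll r πs ρs))
          (trans (cong (restrict σ r) (lookup-zipWith _ i πs ρs)) (restrict-glue σ r _ (ρs-can i)))

  glueAll-cutAll-restrictAll : ∀ r {πs : Vec (Part n) k} → (∀ i → IsCanonical (lookup πs i)) → (∀ i → lookup πs i ⊑ σ) →
                               glueAll r (cutAll r πs) (restrictAll r πs) ≡ πs
  glueAll-cutAll-restrictAll r {πs} πs-can πs⊑σ = lookup-ext λ i →
    trans (lookup-zipWith _ i (cutAll r πs) (restrictAll r πs))
          (trans (cong₂ (glue σ r) (lookup-map i _ πs) (lookup-map i _ πs)) (glue-cut-restrict σ r (πs-can i) (πs⊑σ i)))

  cutAll-glueAll : ∀ r {πs : Vec (Part n) k} ρs → (∀ i → IsCanonical (lookup πs i)) →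
                   (∀ i {a a′} → rep σ a ≡ r → a ∼[ lookup πs i ] a′ → a ≡ a′) → cutAll r (glueAll r πs ρs) ≡ πs
  cutAll-glueAll r {πs} ρs πs-can trivial = lookup-ext λ i →
    trans (lookup-map i _ (glueAll r πs ρs))
          (trans (cong (cut σ r) (lookup-zipWith _ i πs ρs)) (cut-glue σ r _ (πs-can i) (trivial i)))

module _ {n k : ℕ} {σ : Part n} (σ∈ : σ ∈ NC n) where

  private
    σ-can : IsCanonical σ
    σ-can = proj₁ (∈-NC⁻ σ∈)
    σ-nc : Noncrossing σ
    σ-nc = proj₂ (∈-NC⁻ σ∈)

  -- Good S interpolates between the tuple of singleton partitions (S = []) and the
  -- tuples with join σ (S = representatives σ, see join≡⇒good and good⇒join≡).
  record Good (S : List (Fin n)) (πs : Vec (Part n) k) : Set where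
    field
      below     : ∀ i → lookup πs i ⊑ σ
      supported : ∀ i → Supported σ S (lookup πs i)
      joinOne   : All (λ r → T (joinIsOne (restrictAll σ r πs))) S

  good? : ∀ S → Decidable (Good S)
  good? S πs = map′ (λ (f , s , j) → record { below = f ; supported = s ; joinOne = j })
                    (λ g → Good.below g , Good.supported g , Good.joinOne g)
                    (all? (λ i → lookup πs i ⊑? σ) ×-dec all? (λ i → supported? (lookup πs i)) ×-dec
                     All.all? (λ r → T? (joinIsOne (restrictAll σ r πs))) S)
    where
    supported? : ∀ π → Dec (Supported σ S π)
    supported? π = all? λ a → all? λ a′ → (rep π a ≟ rep π a′) →-dec ((a ≟ a′) ⊎-dec any? (rep σ a ≟_) S)

  goodTuples : List (Fin n) → List (Vec (Part n) k)
  goodTuples S = filter (good? S) (tuples (NC n) k)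

  ∈-goodTuples⁺ : ∀ {S πs} → (∀ i → lookup πs i ∈ NC n) → Good S πs → πs ∈ goodTuples S
  ∈-goodTuples⁺ {S} πs∈ g = ∈-filter⁺ (good? S) (∈-tuples⁺ πs∈) g

  ∈-goodTuples⁻ : ∀ {S πs} → πs ∈ goodTuples S → (∀ i → lookup πs i ∈ NC n) × Good S πs
  ∈-goodTuples⁻ {S} πs∈ with ∈-filter⁻ (good? S) {xs = tuples (NC n) k} πs∈
  ... | πs∈tuples , g = ∈-tuples⁻ πs∈tuples , g

  goodTuples-unique : ∀ S → Unique (goodTuples S)
  goodTuples-unique S = Unique.filter⁺ (good? S) (tuples-unique k (NC-unique n))

  goodTuples-[] : goodTuples [] ≡ [ replicate k (singletons n) ]
  goodTuples-[] = filter-unique (good? []) (tuples-unique k (NC-unique n))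
    (∈-tuples⁺ λ i → subst (_∈ NC n) (sym (lookup-replicate i _)) (singletons-NC n)) good-singletons only
    where
    good-singletons : Good [] (replicate k (singletons n))
    good-singletons = record
      { below     = λ i → subst (_⊑ σ) (sym (lookup-replicate i _)) (singletons-⊑ σ)
      ; supported = λ i a a′ a∼a′ → inj₁ (singletons-∼ (subst (λ π → a ∼[ π ] a′) (lookup-replicate i _) a∼a′))
      ; joinOne   = []
      }
    only : ∀ {πs} → πs ∈ tuples (NC n) k → Good [] πs → πs ≡ replicate k (singletons n)
    only {πs} πs∈ g = lookup-ext λ i →
      trans (⊑-antisym _ _ (proj₁ (∈-NC⁻ (∈-tuples⁻ πs∈ i))) (proj₁ (∈-NC⁻ (singletons-NC n)))
                       (λ a a′ a∼a′ → trivial (Good.supported g i a a′ a∼a′)) (singletons-⊑ (lookup πs i)))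
            (sym (lookup-replicate i _))
      where
      trivial : ∀ {a a′} → a ≡ a′ ⊎ rep σ a ∈ [] → a ∼[ singletons n ] a′
      trivial (inj₁ refl) = refl

  cutAll-∈ : ∀ {r S πs} → All (r ≢_) S → πs ∈ goodTuples (r ∷ S) → cutAll σ r πs ∈ goodTuples S
  cutAll-∈ {r} {S} {πs} r∉S πs∈ = ∈-goodTuples⁺
    (λ i → subst (_∈ NC n) (sym (lookup-map i (cut σ r) πs)) (cut-NC σ r (lookup πs i) (proj₂ (∈-NC⁻ (πs-NC i)))))
    (record
      { below     = λ i → subst (_⊑ σ) (sym (lookup-map i (cut σ r) πs)) (cut-⊑ σ r (lookup πs i) (below i))
      ; supported = λ i → subst (Supported σ S) (sym (lookup-map i (cut σ r) πs)) (supported-cut σ {π = lookup πs i} (supported i))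
      ; joinOne   = All.zipWith (λ (r≢r′ , j) → subst (T ∘ joinIsOne) (sym (restrictAll-cutAll-other σ (r≢r′ ∘ sym) πs)) j)
                                (r∉S , All.tail joinOne)
      })
    where
    πs-NC : ∀ i → lookup πs i ∈ NC n
    πs-NC = proj₁ (∈-goodTuples⁻ πs∈)
    open Good (proj₂ (∈-goodTuples⁻ πs∈))

  restrictAll-∈ : ∀ {r S πs} → πs ∈ goodTuples (r ∷ S) → restrictAll σ r πs ∈ joinOneTuples k (size σ r)
  restrictAll-∈ {r} {S} {πs} πs∈ = ∈-joinOneTuples⁺
    (λ i → subst (_∈ NC (size σ r)) (sym (lookup-map i (restrict σ r) πs)) (restrict-NC σ r (lookup πs i) (proj₂ (∈-NC⁻ (proj₁ (∈-goodTuples⁻ πs∈) i)))))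
    (All.head (Good.joinOne (proj₂ (∈-goodTuples⁻ πs∈))))

  glueAll-∈ : ∀ {r S πs ρs} → All (r ≢_) S → πs ∈ goodTuples S → ρs ∈ joinOneTuples k (size σ r) → glueAll σ r πs ρs ∈ goodTuples (r ∷ S)
  glueAll-∈ {r} {S} {πs} {ρs} r∉S πs∈ ρs∈ = ∈-goodTuples⁺
    (λ i → subst (_∈ NC n) (sym (lookup-zipWith (glue σ r) i πs ρs)) (glue-NC σ r (lookup πs i) (lookup ρs i) σ-nc (proj₂ (∈-NC⁻ (πs-NC i))) (below i) (ρs-NC i)))
    (record
      { below     = λ i → subst (_⊑ σ) (sym (lookup-zipWith (glue σ r) i πs ρs)) (glue-⊑ σ r (lookup πs i) (lookup ρs i) (below i))
      ; supported = λ i → subst (Supported σ (r ∷ S)) (sym (lookup-zipWith (glue σ r) i πs ρs)) (supported-glue σ {π = lookup πs i} {ρ = lookup ρs i} (supported i))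
      ; joinOne   = subst (T ∘ joinIsOne) (sym (restrictAll-glueAll σ r πs (proj₁ ∘ ∈-NC⁻ ∘ ρs-NC))) ρs-joinOne
                  ∷ All.zipWith (λ (r≢r′ , j) → subst (T ∘ joinIsOne) (sym (restrictAll-glueAll-other σ (r≢r′ ∘ sym) πs ρs)) j)
                                (r∉S , joinOne)
      })
    where
    πs-NC : ∀ i → lookup πs i ∈ NC n
    πs-NC = proj₁ (∈-goodTuples⁻ πs∈)
    open Good (proj₂ (∈-goodTuples⁻ πs∈))
    ρs-NC : ∀ i → lookup ρs i ∈ NC (size σ r)
    ρs-NC = proj₁ (∈-joinOneTuples⁻ ρs∈)
    ρs-joinOne : T (joinIsOne ρs)
    ρs-joinOne = proj₂ (∈-joinOneTuples⁻ ρs∈)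

  join≡⇒good : ∀ {πs} → join πs ≡ σ → Good (representatives σ) πs
  join≡⇒good {πs} join≡σ = record
    { below     = πs⊑σ
    ; supported = λ i a a′ _ → inj₂ (∈-representatives⁺ σ (proj₂ (σ-can a)))
    ; joinOne   = All.tabulate λ {r} _ → joinIsOne⁺ (restrictAll σ r πs) (restrictions-joinOne r)
    }
    where
    πs⊑σ : ∀ i → lookup πs i ⊑ σ
    πs⊑σ i = subst (lookup πs i ⊑_) join≡σ (join-upperBound πs i)
    restrictions-joinOne : ∀ r → JoinIsOne (restrictAll σ r πs)
    restrictions-joinOne r τ τ∈ τ-ub y y′ =
      glueRel-inside σ r (cut σ r σ) τ (glue-∼⁻ σ r _ _ (σ⊑τ′ _ _ (trans (embed-∈ σ r y) (sym (embed-∈ σ r y′)))))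
      where
      τ′ : Part n
      τ′ = glue σ r (cut σ r σ) τ
      τ′∈ : τ′ ∈ NC n
      τ′∈ = glue-NC σ r (cut σ r σ) τ σ-nc (proj₂ (∈-NC⁻ (cut-NC σ r σ σ-nc))) (cut-⊑ σ r σ (⊑-refl {π = σ})) τ∈
      τ′-ub : UpperBound πs τ′
      τ′-ub i a a′ a∼a′ with sameSide σ r (πs⊑σ i a a′ a∼a′)
      ... | bothInside y y′ refl refl = glue-∼⁺ σ r _ τ (inside refl refl
              (τ-ub i y y′ (subst (λ ρ → y ∼[ ρ ] y′) (sym (lookup-map i (restrict σ r) πs)) (restrict-∼⁺ σ r (lookup πs i) a∼a′))))
      ... | bothOutside a∉r a′∉r = glue-∼⁺ σ r _ τ (outside a∉r a′∉r (cut-∼⁺ σ r σ a∉r a′∉r (πs⊑σ i a a′ a∼a′)))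
      σ⊑τ′ : σ ⊑ τ′
      σ⊑τ′ = subst (_⊑ τ′) join≡σ (join-least πs τ′ τ′∈ τ′-ub)

  good⇒join≡ : ∀ {πs} → Good (representatives σ) πs → join πs ≡ σ
  good⇒join≡ {πs} g = join-unique πs σ σ∈ below least
    where
    open Good g
    least : ∀ τ → τ ∈ NC n → UpperBound πs τ → σ ⊑ τ
    least τ τ∈ τ-ub a a′ a∼a′ with sameSide σ (rep σ a) a∼a′
    ... | bothOutside a∉ _ = ⊥-elim (a∉ refl)
    ... | bothInside y y′ ey ey′ = subst₂ (_∼[ τ ]_) ey ey′ (restrict-∼⁻ σ (rep σ a) τ (restriction-one y y′))
      where
      restriction-ub : UpperBound (restrictAll σ (rep σ a) πs) (restrict σ (rep σ a) τ)
      restriction-ub i z z′ z∼z′ = restrict-∼⁺ σ (rep σ a) τ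
        (τ-ub i _ _ (restrict-∼⁻ σ (rep σ a) (lookup πs i) (subst (λ ρ → z ∼[ ρ ] z′) (lookup-map i (restrict σ (rep σ a)) πs) z∼z′)))
      restriction-one : IsOne (restrict σ (rep σ a) τ)
      restriction-one = joinIsOne⁻ (restrictAll σ (rep σ a) πs)
        (All.lookup joinOne (∈-representatives⁺ σ (proj₂ (σ-can a))))
        (restrict σ (rep σ a) τ) (restrict-NC σ (rep σ a) τ (proj₂ (∈-NC⁻ τ∈))) restriction-ub

module _ {c ℓ} (A : CommutativeRing c ℓ) {k : ℕ} (Rs : Fin k → ℕ → CommutativeRing.Carrier A) where
  open CommutativeRing A hiding (zero) renaming (refl to ≈-refl; sym to ≈-sym; trans to ≈-trans; reflexive to ≈-reflexive)
  open BigOperators A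
  open import Relation.Binary.Reasoning.Setoid setoid

  weight : Vec (Part m) k → Carrier
  weight πs = ∏ (λ i → multPart A (Rs i) (lookup πs i)) (allFin k)

  module _ {n : ℕ} {σ : Part n} (σ∈ : σ ∈ NC n) where

    weightOn : List (Fin n) → Vec (Part n) k → Carrier
    weightOn S πs = ∏ (λ r → weight (restrictAll σ r πs)) S

    ∑-goodTuples-∷ : ∀ {r S} → All (r ≢_) S →
      ∑ (weightOn (r ∷ S)) (goodTuples σ∈ (r ∷ S)) ≈
      ∑ (λ (πs , ρs) → weightOn S πs * weight ρs) (cartesianProduct (goodTuples σ∈ S) (joinOneTuples k (size σ r)))
    ∑-goodTuples-∷ {r} {S} r∉S =
      ∑-reindex (Product.≡-dec (Vec.≡-dec _≟ₚ_) (Vec.≡-dec _≟ₚ_)) (weightOn (r ∷ S)) (λ (πs , ρs) → weightOn S πs * weight ρs)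
        split glue′ (goodTuples-unique σ∈ (r ∷ S)) (Unique.cartesianProduct⁺ (goodTuples-unique σ∈ S) joinOneTuples-unique)
        split-∈ glue-∈ glue∘split split∘glue weight-split
      where
      pairs : List (Vec (Part n) k × Vec (Part (size σ r)) k)
      pairs = cartesianProduct (goodTuples σ∈ S) (joinOneTuples k (size σ r))
      split : Vec (Part n) k → Vec (Part n) k × Vec (Part (size σ r)) k
      split πs = cutAll σ r πs , restrictAll σ r πs
      glue′ : Vec (Part n) k × Vec (Part (size σ r)) k → Vec (Part n) k
      glue′ (πs , ρs) = glueAll σ r πs ρs
      split-∈ : ∀ {πs} → πs ∈ goodTuples σ∈ (r ∷ S) → split πs ∈ pairs
      split-∈ πs∈ = ∈-cartesianProduct⁺ (cutAll-∈ σ∈ r∉S πs∈) (restrictAll-∈ σ∈ πs∈)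
      glue-∈ : ∀ {p} → p ∈ pairs → glue′ p ∈ goodTuples σ∈ (r ∷ S)
      glue-∈ p∈ = let πs∈ , ρs∈ = ∈-cartesianProduct⁻ _ _ p∈ in glueAll-∈ σ∈ r∉S πs∈ ρs∈
      glue∘split : ∀ {πs} → πs ∈ goodTuples σ∈ (r ∷ S) → glue′ (split πs) ≡ πs
      glue∘split πs∈ = let πs-NC , g = ∈-goodTuples⁻ σ∈ πs∈ in
        glueAll-cutAll-restrictAll σ r (proj₁ ∘ ∈-NC⁻ ∘ πs-NC) (Good.below g)
      split∘glue : ∀ {p} → p ∈ pairs → split (glue′ p) ≡ p
      split∘glue {πs , ρs} p∈ = let πs∈ , ρs∈ = ∈-cartesianProduct⁻ _ _ p∈ ; πs-NC , g = ∈-goodTuples⁻ σ∈ πs∈ in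
        cong₂ _,_ (cutAll-glueAll σ r ρs (proj₁ ∘ ∈-NC⁻ ∘ πs-NC) (λ i → supported-trivial σ {π = lookup πs i} r∉S (Good.supported g i)))
                  (restrictAll-glueAll σ r πs (proj₁ ∘ ∈-NC⁻ ∘ proj₁ (∈-joinOneTuples⁻ ρs∈)))
      weight-split : ∀ {πs} → πs ∈ goodTuples σ∈ (r ∷ S) → weightOn (r ∷ S) πs ≈ weightOn S (cutAll σ r πs) * weight (restrictAll σ r πs)
      weight-split {πs} _ = ≈-trans (*-comm _ _) (*-cong (∏-cong S (λ r′∈S → ≈-reflexive
        (cong weight (sym (restrictAll-cutAll-other σ (All.lookup r∉S r′∈S ∘ sym) πs))))) ≈-refl)

    ∑-goodTuples : ∀ {S} → Unique S → ∑ (weightOn S) (goodTuples σ∈ S) ≈ ∏ (λ r → productFormula A k Rs (size σ r)) S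
    ∑-goodTuples {[]} _ = ≈-trans (≈-reflexive (cong (∑ (weightOn [])) (goodTuples-[] σ∈))) (+-identityʳ 1#)
    ∑-goodTuples {r ∷ S} (r∉S ∷ S!) = begin
      ∑ (weightOn (r ∷ S)) (goodTuples σ∈ (r ∷ S))
        ≈⟨ ∑-goodTuples-∷ r∉S ⟩
      ∑ (λ (πs , ρs) → weightOn S πs * weight ρs) (cartesianProduct (goodTuples σ∈ S) (joinOneTuples k (size σ r)))
        ≈⟨ ∑-cartesianProduct (λ (πs , ρs) → weightOn S πs * weight ρs) (goodTuples σ∈ S) (joinOneTuples k (size σ r)) ⟩
      ∑ (λ πs → ∑ (λ ρs → weightOn S πs * weight ρs) (joinOneTuples k (size σ r))) (goodTuples σ∈ S)
        ≈⟨ ∑-*-∑ (weightOn S) weight (goodTuples σ∈ S) (joinOneTuples k (size σ r)) ⟨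
      ∑ (weightOn S) (goodTuples σ∈ S) * productFormula A k Rs (size σ r)
        ≈⟨ *-cong (∑-goodTuples S!) ≈-refl ⟩
      ∏ (λ r → productFormula A k Rs (size σ r)) S * productFormula A k Rs (size σ r)
        ≈⟨ *-comm _ _ ⟩
      ∏ (λ r → productFormula A k Rs (size σ r)) (r ∷ S) ∎

    weight-restrict : ∀ πs → (∀ i → IsCanonical (lookup πs i)) → (∀ i → lookup πs i ⊑ σ) →
                      weight πs ≈ weightOn (representatives σ) πs
    weight-restrict πs πs-can πs⊑σ = begin
      ∏ (λ i → multPart A (Rs i) (lookup πs i)) (allFin k)
        ≈⟨ ∏-cong (allFin k) (λ {i} _ → multPart-restrict A (Rs i) {σ} {lookup πs i} σ-can (πs-can i) (πs⊑σ i)) ⟩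
      ∏ (λ i → ∏ (λ r → multPart A (Rs i) (restrict σ r (lookup πs i))) (representatives σ)) (allFin k)
        ≈⟨ ∏-swap (λ i r → multPart A (Rs i) (restrict σ r (lookup πs i))) (allFin k) (representatives σ) ⟩
      ∏ (λ r → ∏ (λ i → multPart A (Rs i) (restrict σ r (lookup πs i))) (allFin k)) (representatives σ)
        ≈⟨ ∏-cong (representatives σ) (λ {r} _ → ∏-cong (allFin k) (λ {i} _ →
             ≈-reflexive (cong (multPart A (Rs i)) (sym (lookup-map i (restrict σ r) πs))))) ⟩
      weightOn (representatives σ) πs ∎
      where
      σ-can : IsCanonical σ
      σ-can = proj₁ (∈-NC⁻ σ∈)

    ∑-join≡ : ∑ weight (filter (λ πs → join πs ≟ₚ σ) (tuples (NC n) k)) ≈ multPart A (productFormula A k Rs) σ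
    ∑-join≡ = begin
      ∑ weight (filter (λ πs → join πs ≟ₚ σ) (tuples (NC n) k))
        ≡⟨ cong (∑ weight) (filter-≐ _ (good? σ∈ (representatives σ)) (join≡⇒good σ∈ , good⇒join≡ σ∈) (tuples (NC n) k)) ⟩
      ∑ weight (goodTuples σ∈ (representatives σ))
        ≈⟨ ∑-cong (goodTuples σ∈ (representatives σ)) (λ {πs} πs∈ → let πs-NC , g = ∈-goodTuples⁻ σ∈ πs∈ in
             weight-restrict πs (proj₁ ∘ ∈-NC⁻ ∘ πs-NC) (Good.below g)) ⟩
      ∑ (weightOn (representatives σ)) (goodTuples σ∈ (representatives σ))
        ≈⟨ ∑-goodTuples (representatives-unique σ) ⟩
      ∏ (λ r → productFormula A k Rs (size σ r)) (representatives σ) ∎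

  ∑-weight-tuples : ∀ n → ∑ weight (tuples (NC n) k) ≈ ∑ (multPart A (productFormula A k Rs)) (NC n)
  ∑-weight-tuples n = ≈-trans (∑-fibres _≟ₚ_ weight join (tuples (NC n) k) (NC-unique n) (λ {πs} _ → join-NC πs))
                              (∑-cong (NC n) ∑-join≡)

theorem1p2 : {c ℓ : Level} (A : CommutativeRing c ℓ) (k : ℕ)
    (M Rs : Fin k → ℕ → CommutativeRing.Carrier A)
    (Rprod : ℕ → CommutativeRing.Carrier A) →
    ((i : Fin k) → FreeCumulantsOf A (M i) (Rs i)) →
    FreeCumulantsOf A (λ n → prodFin A k (λ i → M i n)) Rprod →
    (n : ℕ) → 1 ≤ n →
    CommutativeRing._≈_ A (Rprod n) (productFormula A k Rs n)
theorem1p2 A k M Rs Rprod Rs-cumulants Rprod-cumulants = free-cumulants-unique A Rprod (productFormula A k Rs) same-moments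
  where
  open CommutativeRing A using (_≈_)
  open BigOperators A
  open import Relation.Binary.Reasoning.Setoid (CommutativeRing.setoid A)
  same-moments : ∀ m → 1 ≤ m → ∑ (multPart A Rprod) (NC m) ≈ ∑ (multPart A (productFormula A k Rs)) (NC m)
  same-moments m 1≤m = begin
    ∑ (multPart A Rprod) (NC m)                              ≈⟨ Rprod-cumulants m 1≤m ⟨
    ∏ (λ i → M i m) (allFin k)                               ≈⟨ ∏-cong (allFin k) (λ {i} _ → Rs-cumulants i m 1≤m) ⟩
    ∏ (λ i → ∑ (multPart A (Rs i)) (NC m)) (allFin k)        ≈⟨ ∏-∑-tuples k (λ i → multPart A (Rs i)) (NC m) ⟩
    ∑ (weight A Rs) (tuples (NC m) k)                         ≈⟨ ∑-weight-tuples A Rs m ⟩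
    ∑ (multPart A (productFormula A k Rs)) (NC m)            ∎
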